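{- For every $n\ge 1$, the number of $\{132,231\}$-sortable permutations of length $n$ equals the large Schröder number $r_{n-1}$, where $r_m=\sum_{k=0}^{m}\binom{m+k}{m-k}c_k$ (so $r_0,r_1,r_2,r_3,\ldots=1,2,6,22,\ldots$, OEIS A006318) and $c_k=\frac{1}{k+1}\binom{2k}{k}$.
   Context: For a set $T$ of patterns, a $T$-stack is a stack whose content, read top to bottom, must never contain an occurrence (subsequence order-isomorphic) of a pattern of $T$; an input is processed greedily: push the next input element if this creates no forbidden occurrence in the stack, otherwise pop the top element to the output. The $T$-machine is the $T$-stack followed by a $\{21\}$-stack (classical stack, greedy); a permutation $\pi$ is $T$-sortable if the output of the $T$-machine on $\pi$ is the increasing permutation. -}

module Defs where

open import Data.Nat using (ℕ; zero; suc; _+_; _*_; _∸_; _/_; _≡ᵇ_; _<ᵇ_)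
open import Data.Nat.Combinatorics using (_C_)
open import Data.Bool using (Bool; true; false; _∧_; not; if_then_else_)
open import Data.List using (List; []; _∷_; _++_; map; length; upTo; zip)
open import Data.Bool.ListAction using (any; all)
open import Data.Nat.ListAction using (sum)
open import Data.List.Properties using (≡-dec)
open import Data.Product using (_×_; _,_)
open import Data.Nat.Properties using (_≟_)
open import Relation.Nullary.Decidable using (isYes; does)

private
  _==_ : Bool → Bool → Bool
  true == b = b
  false == b = not b

subseqs : List ℕ → List (List ℕ)
subseqs [] = [] ∷ []
subseqs (x ∷ xs) = map (x ∷_) (subseqs xs) ++ subseqs xs

pairs : {A : Set} → List A → List (A × A)
pairs [] = []
pairs (x ∷ xs) = map (x ,_) xs ++ pairs xs

sameLength : List ℕ → List ℕ → Bool
sameLength [] [] = true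
sameLength (_ ∷ xs) (_ ∷ ys) = sameLength xs ys
sameLength _ _ = false

orderIso : List ℕ → List ℕ → Bool
orderIso xs ys = sameLength xs ys ∧ all ok (pairs (zip xs ys))
  where
  ok : (ℕ × ℕ) × (ℕ × ℕ) → Bool
  ok ((x , y) , (x' , y')) =
    ((x <ᵇ x') == (y <ᵇ y')) ∧ ((x ≡ᵇ x') == (y ≡ᵇ y')) ∧ ((x' <ᵇ x) == (y' <ᵇ y))

containsSome : List (List ℕ) → List ℕ → Bool
containsSome T w = any (λ s → any (orderIso s) T) (subseqs w)

-- greedy popping before pushing x: pop the top of the stack (stack read
-- top to bottom) to the output until pushing x creates no forbidden
-- occurrence.
popUntil : List (List ℕ) → ℕ → List ℕ → List ℕ × List ℕ
popUntil T x s with containsSome T (x ∷ s)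
popUntil T x s | false = [] , s
popUntil T x [] | true = [] , []   -- unreachable when all patterns have length ≥ 2
popUntil T x (y ∷ s) | true with popUntil T x s
... | (o , r) = (y ∷ o) , r

tStackRun : List (List ℕ) → List ℕ → List ℕ → List ℕ
tStackRun T [] s = s
tStackRun T (x ∷ xs) s with popUntil T x s
... | (o , r) = o ++ tStackRun T xs (x ∷ r)

tStack : List (List ℕ) → List ℕ → List ℕ
tStack T π = tStackRun T π []

p21 : List ℕ
p21 = 2 ∷ 1 ∷ []

tMachine : List (List ℕ) → List ℕ → List ℕ
tMachine T π = tStack (p21 ∷ []) (tStack T π)

idPerm : ℕ → List ℕ
idPerm n = map suc (upTo n)

occ : ℕ → List ℕ → ℕ
occ i [] = 0
occ i (j ∷ w) = (if i ≡ᵇ j then 1 else 0) + occ i w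

isPerm : ℕ → List ℕ → Bool
isPerm n π = (length π ≡ᵇ n) ∧ all (λ i → occ i π ≡ᵇ 1) (idPerm n)

isSortable : List (List ℕ) → List ℕ → Bool
isSortable T π = isYes (≡-dec _≟_ (tMachine T π) (idPerm (length π)))

catalan : ℕ → ℕ
catalan k = ((2 * k) C k) / suc k

schroeder : ℕ → ℕ
schroeder m = sum (map (λ k → ((m + k) C (m ∸ k)) * catalan k) (upTo (suc m)))

p132 p231 : List ℕ
p132 = 1 ∷ 3 ∷ 2 ∷ []
p231 = 2 ∷ 3 ∷ 1 ∷ []

module Submission where

-- Deleting the maximum n+1 from a sortable permutation of length n+1 leaves a
-- sortable permutation σ. Conversely, n+1 may be inserted into σ exactly within
-- the longest prefix of σ that the {132,231}-stack pushes without popping (its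
-- length is the label of σ): n+1 then goes through both stacks without
-- disturbing the rest, while inserted later it makes the {132,231}-stack pop an
-- entry larger than one still on the stack, which the classical stack cannot
-- repair. Inserting in front lengthens the prefix by one and inserting after k
-- entries cuts it to k + 1, so the labels follow the generating tree
-- (L) → (L+1)(2)(3)…(L+1) from the root (1). The number of nodes on level m of
-- this tree is the number of Schröder paths of semilength m; placing the m − k
-- flat steps among the steps of one of the c_k Dyck paths of semilength k gives
-- r_m = Σ_k C(m+k, m−k) c_k.

open import Defs
open import Data.Nat
open import Data.Nat.Properties
open import Data.Nat.Combinatorics
open import Data.Nat.DivMod using (_/_; m*n/n≡m; m/n*n≡m)
open import Data.Nat.ListAction using (sum)
open import Data.Nat.Tactic.RingSolver using (solve-∀)
open import Data.Bool using (Bool; true; false; _∧_; _∨_; not; if_then_else_; T)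
open import Data.Bool.Properties using (∨-identityʳ; ∨-assoc; ∨-zeroʳ; ∧-identityʳ; ∧-zeroʳ; not-injective; ¬-not; T-≡; T-irrelevant)
open import Data.Bool.ListAction using (any; all)
open import Data.List using (List; []; _∷_; _++_; [_]; map; applyUpTo; upTo; length; take; drop; _ʳ++_)
open import Data.List.Properties
  using (++-assoc; ++-identityʳ; map-++; map-applyUpTo; ∷ʳ-injectiveˡ; applyUpTo-∷ʳ; ≡-dec; take++drop≡id; length-++-sucʳ; length-++-≤ˡ; length-take)
open import Data.Product using (Σ; _×_; _,_; proj₁; proj₂; ∃; ∃₂)
open import Data.Product.Function.Dependent.Propositional using (Σ-↔)
open import Data.Sum using (_⊎_; inj₁; inj₂)
open import Data.Sum.Function.Propositional using (_⊎-↔_)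
open import Data.Unit using (⊤; tt)
open import Data.Empty using (⊥-elim)
open import Data.Fin using (Fin; toℕ; fromℕ<) renaming (zero to fzero; suc to fsuc)
open import Data.Fin.Properties using (toℕ-injective; toℕ-fromℕ<; toℕ<n; +↔⊎)
open import Function using (_∘_; id; Equivalence)
open import Function.Bundles using (_↔_; mk↔ₛ′; Inverse)
open import Function.Properties.Inverse using (↔-refl; ↔-sym; ↔-trans)
open import Function.Related.Propositional using (module EquationalReasoning)
open import Function.Related.TypeIsomorphisms using (Σ-assoc)
open import Relation.Binary.Definitions using (tri<; tri≈; tri>)
open import Relation.Binary.PropositionalEquality hiding ([_])
open import Relation.Nullary using (¬_; Dec; yes; no)
open import Relation.Nullary.Decidable using (isYes)

-- Schröder paths

-- The number of paths from height h down to 0 with f flat steps and b up steps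
-- (hence h + b down steps) that never go below 0.
paths : ℕ → ℕ → ℕ → ℕ
paths zero    zero    zero    = 1
paths zero    zero    (suc b) = paths zero 1 b
paths zero    (suc h) zero    = paths zero h zero
paths zero    (suc h) (suc b) = paths zero h (suc b) + paths zero (suc (suc h)) b
paths (suc f) zero    zero    = paths f zero zero
paths (suc f) zero    (suc b) = paths f zero (suc b) + paths (suc f) 1 b
paths (suc f) (suc h) zero    = paths f (suc h) zero + paths (suc f) h zero
paths (suc f) (suc h) (suc b) =
  paths f (suc h) (suc b) + paths (suc f) h (suc b) + paths (suc f) (suc (suc h)) b

pathLength : ℕ → ℕ → ℕ → ℕ
pathLength f h b = f + (h + (b + b))

pascal-* : ∀ n k z → (suc n C suc k) * z ≡ (n C k) * z + (n C suc k) * z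
pascal-* n k z = begin
  (suc n C suc k) * z           ≡⟨ cong (_* z) (nCk+nC[k+1]≡[n+1]C[k+1] n k) ⟨
  (n C k + n C suc k) * z       ≡⟨ *-distribʳ-+ z (n C k) (n C suc k) ⟩
  (n C k) * z + (n C suc k) * z ∎
  where open ≡-Reasoning

paths-descent : ∀ h → paths 0 h 0 ≡ 1
paths-descent zero    = refl
paths-descent (suc h) = paths-descent h

-- The flat steps can be placed freely among the other steps.
paths-interleave : ∀ f h b → paths f h b ≡ (pathLength f h b C f) * paths 0 h b
paths-interleave zero h b = sym (+-identityʳ (paths 0 h b))
paths-interleave (suc f) zero zero = begin
  paths f 0 0                               ≡⟨ paths-interleave f 0 0 ⟩
  (n C f) * 1                               ≡⟨ +-identityʳ _ ⟨
  (n C f) * 1 + 0 * 1                       ≡⟨ cong (λ m → (n C f) * 1 + m * 1) (k>n⇒nCk≡0 (s≤s (≤-reflexive (+-identityʳ f)))) ⟨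
  (n C f) * 1 + (n C suc f) * 1             ≡⟨ pascal-* n f 1 ⟨
  (suc n C suc f) * 1                       ∎
  where open ≡-Reasoning
        n = f + 0
paths-interleave (suc f) zero (suc b) = begin
  paths f 0 (suc b) + paths (suc f) 1 b
    ≡⟨ cong₂ _+_ (paths-interleave f 0 (suc b)) (paths-interleave (suc f) 1 b) ⟩
  (n C f) * z + (pathLength (suc f) 1 b C suc f) * z
    ≡⟨ cong (λ m → (n C f) * z + (m C suc f) * z) (length-eq f b) ⟩
  (n C f) * z + (n C suc f) * z
    ≡⟨ pascal-* n f z ⟨
  (suc n C suc f) * z ∎
  where open ≡-Reasoning
        n = pathLength f 0 (suc b)
        z = paths 0 0 (suc b)
        length-eq : ∀ f b → suc f + (1 + (b + b)) ≡ f + (0 + (suc b + suc b))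
        length-eq = solve-∀
paths-interleave (suc f) (suc h) zero = begin
  paths f (suc h) 0 + paths (suc f) h 0
    ≡⟨ cong₂ _+_ (paths-interleave f (suc h) 0) (paths-interleave (suc f) h 0) ⟩
  (n C f) * z + (pathLength (suc f) h 0 C suc f) * z
    ≡⟨ cong (λ m → (n C f) * z + (m C suc f) * z) (sym (+-suc f (h + 0))) ⟩
  (n C f) * z + (n C suc f) * z
    ≡⟨ pascal-* n f z ⟨
  (suc n C suc f) * z ∎
  where open ≡-Reasoning
        n = pathLength f (suc h) 0
        z = paths 0 (suc h) 0
paths-interleave (suc f) (suc h) (suc b) = begin
  paths f (suc h) (suc b) + paths (suc f) h (suc b) + paths (suc f) (suc (suc h)) b
    ≡⟨ cong₂ _+_ (cong₂ _+_ (paths-interleave f (suc h) (suc b)) (paths-interleave (suc f) h (suc b)))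
                 (paths-interleave (suc f) (suc (suc h)) b) ⟩
  (n C f) * z + (pathLength (suc f) h (suc b) C suc f) * x + (pathLength (suc f) (suc (suc h)) b C suc f) * y
    ≡⟨ cong₂ (λ m m' → (n C f) * z + (m C suc f) * x + (m' C suc f) * y) (sym (+-suc f _)) (length-eq f h b) ⟩
  (n C f) * z + (n C suc f) * x + (n C suc f) * y
    ≡⟨ +-assoc ((n C f) * z) _ _ ⟩
  (n C f) * z + ((n C suc f) * x + (n C suc f) * y)
    ≡⟨ cong ((n C f) * z +_) (*-distribˡ-+ (n C suc f) x y) ⟨
  (n C f) * z + (n C suc f) * z
    ≡⟨ pascal-* n f z ⟨
  (suc n C suc f) * z ∎
  where open ≡-Reasoning
        n = pathLength f (suc h) (suc b)
        x = paths 0 h (suc b)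
        y = paths 0 (suc (suc h)) b
        z = paths 0 (suc h) (suc b)
        length-eq : ∀ f h b → suc f + (suc (suc h) + (b + b)) ≡ f + (suc h + (suc b + suc b))
        length-eq = solve-∀

central-C-sym : ∀ c → (suc (suc c + suc c)) C suc c ≡ (suc (suc c + suc c)) C suc (suc c)
central-C-sym c = trans (nCk≡nC[n∸k] c<n) (cong (n C_) n∸c≡)
  where
  n = suc (suc c + suc c)
  c<n : suc c ≤ n
  c<n = ≤-trans (m≤m+n (suc c) (suc c)) (n≤1+n _)
  n∸c≡ : n ∸ suc c ≡ suc (suc c)
  n∸c≡ = m+n∸n≡m (suc (suc c)) (suc c)

ballot : ∀ h c → paths 0 h (suc c) + pathLength 0 h (suc c) C c ≡ pathLength 0 h (suc c) C suc c
ballot zero zero = refl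
ballot zero (suc c) = subst (λ m → paths 0 0 (suc (suc c)) + m C suc c ≡ m C suc (suc c)) (length-eq c) (begin
  paths 0 1 (suc c) + (suc n C suc c)             ≡⟨ cong (paths 0 1 (suc c) +_) (nCk+nC[k+1]≡[n+1]C[k+1] n c) ⟨
  paths 0 1 (suc c) + (n C c + n C suc c)         ≡⟨ +-assoc (paths 0 1 (suc c)) _ _ ⟨
  paths 0 1 (suc c) + n C c + n C suc c           ≡⟨ cong (_+ (n C suc c)) (ballot 1 c) ⟩
  n C suc c + n C suc c                           ≡⟨ cong (n C suc c +_) (central-C-sym c) ⟩
  n C suc c + n C suc (suc c)                     ≡⟨ nCk+nC[k+1]≡[n+1]C[k+1] n (suc c) ⟩
  suc n C suc (suc c)                             ∎)
  where open ≡-Reasoning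
        n = pathLength 0 1 (suc c)
        length-eq : ∀ c → suc (1 + (suc c + suc c)) ≡ 0 + (suc (suc c) + suc (suc c))
        length-eq = solve-∀
ballot (suc h) zero = begin
  paths 0 h 1 + paths 0 (suc (suc h)) 0 + 1       ≡⟨ cong (λ w → paths 0 h 1 + w + 1) (paths-descent (suc (suc h))) ⟩
  paths 0 h 1 + 1 + 1                             ≡⟨ cong (_+ 1) (ballot h 0) ⟩
  (n C 1) + 1                                     ≡⟨ +-comm (n C 1) 1 ⟩
  n C 0 + n C 1                                   ≡⟨ nCk+nC[k+1]≡[n+1]C[k+1] n 0 ⟩
  suc n C 1                                       ∎
  where open ≡-Reasoning
        n = pathLength 0 h 1
ballot (suc h) (suc c) = begin
  paths 0 h (suc (suc c)) + paths 0 (suc (suc h)) (suc c) + (suc n C suc c)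
    ≡⟨ cong (paths 0 h (suc (suc c)) + paths 0 (suc (suc h)) (suc c) +_) (nCk+nC[k+1]≡[n+1]C[k+1] n c) ⟨
  paths 0 h (suc (suc c)) + paths 0 (suc (suc h)) (suc c) + (n C c + n C suc c)
    ≡⟨ rearrange (paths 0 h (suc (suc c))) _ _ _ ⟩
  (paths 0 (suc (suc h)) (suc c) + n C c) + (paths 0 h (suc (suc c)) + n C suc c)
    ≡⟨ cong₂ _+_ (subst (λ m → paths 0 (suc (suc h)) (suc c) + m C c ≡ m C suc c) (length-eq h c) (ballot (suc (suc h)) c))
                 (ballot h (suc c)) ⟩
  n C suc c + n C suc (suc c)
    ≡⟨ nCk+nC[k+1]≡[n+1]C[k+1] n (suc c) ⟩
  suc n C suc (suc c) ∎
  where open ≡-Reasoning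
        n = pathLength 0 h (suc (suc c))
        rearrange : ∀ z₁ z₂ a b → z₁ + z₂ + (a + b) ≡ (z₂ + a) + (z₁ + b)
        rearrange = solve-∀
        length-eq : ∀ h c → suc (suc h) + (suc c + suc c) ≡ h + (suc (suc c) + suc (suc c))
        length-eq = solve-∀

C*factorials : ∀ n k → k ≤ n → (n C k) * (k ! * (n ∸ k) !) ≡ n !
C*factorials n k k≤n = trans (cong (_* (k ! * (n ∸ k) !)) (nCk≡n!/k![n-k]! k≤n))
  (m/n*n≡m {{k !* (n ∸ k) !≢0}} (k![n∸k]!∣n! k≤n))

central-C-absorb : ∀ c → suc (suc c) * ((suc c + suc c) C c) ≡ suc c * ((suc c + suc c) C suc c)
central-C-absorb c = *-cancelʳ-≡ _ _ (c ! * suc c !) {{c !* suc c !≢0}} (trans lhs (sym rhs))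
  where
  n = suc c + suc c
  lhs : suc (suc c) * (n C c) * (c ! * suc c !) ≡ n !
  lhs = trans (shuffle c (n C c) (c !) (suc c !))
    (subst (λ x → (n C c) * (c ! * x !) ≡ n !) n∸c≡ (C*factorials n c (≤-trans (n≤1+n c) (m≤m+n (suc c) (suc c)))))
    where
    shuffle : ∀ a x y z → (suc (suc a)) * x * (y * z) ≡ x * (y * (z + suc a * z))
    shuffle = solve-∀
    n∸c≡ : n ∸ c ≡ suc (suc c)
    n∸c≡ = trans (cong (_∸ c) (+-suc (suc c) c)) (m+n∸n≡m (suc (suc c)) c)
  rhs : suc c * (n C suc c) * (c ! * suc c !) ≡ n !
  rhs = trans (shuffle c (n C suc c) (c !) (suc c !))
    (subst (λ x → (n C suc c) * (suc c ! * x !) ≡ n !) (m+n∸m≡n (suc c) (suc c)) (C*factorials n (suc c) (m≤m+n (suc c) (suc c))))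
    where
    shuffle : ∀ a x y z → (suc a) * x * (y * z) ≡ x * ((y + a * y) * z)
    shuffle = solve-∀

catalan≡dyckPaths : ∀ k → catalan k ≡ paths 0 0 k
catalan≡dyckPaths zero = refl
catalan≡dyckPaths (suc c) = begin
  ((2 * suc c) C suc c) / suc (suc c)      ≡⟨ cong (λ x → (x C suc c) / suc (suc c)) (cong (suc c +_) (+-identityʳ (suc c))) ⟩
  Y / suc (suc c)                          ≡⟨ cong (_/ suc (suc c)) times ⟨
  D * suc (suc c) / suc (suc c)            ≡⟨ m*n/n≡m D (suc (suc c)) ⟩
  D                                        ∎
  where
  open ≡-Reasoning
  D = paths 0 0 (suc c)
  X = (suc c + suc c) C c
  Y = (suc c + suc c) C suc c
  times : D * suc (suc c) ≡ Y
  times = trans (*-comm D (suc (suc c))) (+-cancelˡ-≡ (suc c * Y) _ _ (begin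
    suc c * Y + suc (suc c) * D              ≡⟨ +-comm (suc c * Y) _ ⟩
    suc (suc c) * D + suc c * Y              ≡⟨ cong (suc (suc c) * D +_) (central-C-absorb c) ⟨
    suc (suc c) * D + suc (suc c) * X        ≡⟨ *-distribˡ-+ (suc (suc c)) D X ⟨
    suc (suc c) * (D + X)                    ≡⟨ cong (suc (suc c) *_) (ballot 0 c) ⟩
    suc (suc c) * Y                          ≡⟨ +-comm Y (suc c * Y) ⟩
    suc c * Y + Y                            ∎))

antidiagonal : ℕ → (ℕ → ℕ → ℕ) → ℕ
antidiagonal zero    g = g 0 0
antidiagonal (suc s) g = g (suc s) 0 + antidiagonal s (λ f b → g f (suc b))

antidiagonal-cong : ∀ s {g g'} → (∀ f b → g f b ≡ g' f b) → antidiagonal s g ≡ antidiagonal s g'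
antidiagonal-cong zero    e = e 0 0
antidiagonal-cong (suc s) e = cong₂ _+_ (e (suc s) 0) (antidiagonal-cong s (λ f b → e f (suc b)))

antidiagonal-+ : ∀ s g g' → antidiagonal s (λ f b → g f b + g' f b) ≡ antidiagonal s g + antidiagonal s g'
antidiagonal-+ zero    g g' = refl
antidiagonal-+ (suc s) g g' =
  trans (cong (g (suc s) 0 + g' (suc s) 0 +_) (antidiagonal-+ s _ _)) (exchange (g (suc s) 0) (g' (suc s) 0) _ _)
  where exchange : ∀ a b p q → a + b + (p + q) ≡ a + p + (b + q)
        exchange = solve-∀

antidiagonal-zero : ∀ s g → (∀ f b → g f b ≡ 0) → antidiagonal s g ≡ 0
antidiagonal-zero zero    g e = e 0 0
antidiagonal-zero (suc s) g e = cong₂ _+_ (e (suc s) 0) (antidiagonal-zero s _ (λ f b → e f (suc b)))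

antidiagonal-shiftˡ : ∀ s (G g : ℕ → ℕ → ℕ) → (∀ b → g 0 b ≡ 0) → (∀ f b → g (suc f) b ≡ G f b) →
  antidiagonal (suc s) g ≡ antidiagonal s G
antidiagonal-shiftˡ zero    G g z e = trans (cong₂ _+_ (e 0 0) (z 1)) (+-identityʳ (G 0 0))
antidiagonal-shiftˡ (suc s) G g z e =
  cong₂ _+_ (e (suc s) 0) (antidiagonal-shiftˡ s (λ f b → G f (suc b)) (λ f b → g f (suc b)) (λ b → z (suc b)) (λ f b → e f (suc b)))

antidiagonal-shiftʳ : ∀ s (G g : ℕ → ℕ → ℕ) → (∀ f → g f 0 ≡ 0) → (∀ f b → g f (suc b) ≡ G f b) →
  antidiagonal (suc s) g ≡ antidiagonal s G
antidiagonal-shiftʳ s G g z e = cong₂ _+_ (z (suc s)) (antidiagonal-cong s e)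

antidiagonal≡sum : ∀ s G → antidiagonal s G ≡ sum (applyUpTo (λ b → G (s ∸ b) b) (suc s))
antidiagonal≡sum zero    G = sym (+-identityʳ _)
antidiagonal≡sum (suc s) G = cong (G (suc s) 0 +_) (antidiagonal≡sum s (λ f b → G f (suc b)))

emptyPath flatFirst downFirst upFirst : ℕ → ℕ → ℕ → ℕ
emptyPath zero zero zero = 1
emptyPath _    _    _    = 0
flatFirst zero    h b = 0
flatFirst (suc f) h b = paths f h b
downFirst f zero    b = 0
downFirst f (suc h) b = paths f h b
upFirst f h zero    = 0
upFirst f h (suc b) = paths f (suc h) b

paths-firstStep : ∀ f h b → paths f h b ≡ emptyPath f h b + flatFirst f h b + downFirst f h b + upFirst f h b
paths-firstStep zero    zero    zero    = refl
paths-firstStep zero    zero    (suc b) = refl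
paths-firstStep zero    (suc h) zero    = sym (+-identityʳ _)
paths-firstStep zero    (suc h) (suc b) = refl
paths-firstStep (suc f) zero    zero    = sym (trans (+-identityʳ _) (+-identityʳ _))
paths-firstStep (suc f) zero    (suc b) = cong (_+ paths (suc f) 1 b) (sym (+-identityʳ _))
paths-firstStep (suc f) (suc h) zero    = sym (+-identityʳ _)
paths-firstStep (suc f) (suc h) (suc b) = refl

noEmptyAfterUp : ∀ f h b → emptyPath f h (suc b) ≡ 0
noEmptyAfterUp zero    zero    b = refl
noEmptyAfterUp zero    (suc h) b = refl
noEmptyAfterUp (suc f) h       b = refl

-- Paths of size s count each flat and each up step once.
pathsOfSize : ℕ → ℕ → ℕ
pathsOfSize s h = antidiagonal s (λ f b → paths f h b)

pathsDownFirst : ℕ → ℕ → ℕ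
pathsDownFirst s zero    = 0
pathsDownFirst s (suc h) = pathsOfSize (suc s) h

pathsOfSize-suc : ∀ s h → pathsOfSize (suc s) h ≡ pathsOfSize s h + pathsDownFirst s h + pathsOfSize s (suc h)
pathsOfSize-suc s h = begin
  pathsOfSize (suc s) h
    ≡⟨ antidiagonal-cong (suc s) (λ f b → paths-firstStep f h b) ⟩
  antidiagonal (suc s) (λ f b → e f b + fl f b + dn f b + up f b)
    ≡⟨ antidiagonal-+ (suc s) (λ f b → e f b + fl f b + dn f b) up ⟩
  antidiagonal (suc s) (λ f b → e f b + fl f b + dn f b) + antidiagonal (suc s) up
    ≡⟨ cong (_+ antidiagonal (suc s) up) (antidiagonal-+ (suc s) (λ f b → e f b + fl f b) dn) ⟩
  antidiagonal (suc s) (λ f b → e f b + fl f b) + antidiagonal (suc s) dn + antidiagonal (suc s) up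
    ≡⟨ cong (λ w → w + antidiagonal (suc s) dn + antidiagonal (suc s) up) (antidiagonal-+ (suc s) e fl) ⟩
  antidiagonal (suc s) e + antidiagonal (suc s) fl + antidiagonal (suc s) dn + antidiagonal (suc s) up
    ≡⟨ cong₂ _+_ (cong₂ _+_ (cong₂ _+_ (antidiagonal-zero s _ (λ f b → noEmptyAfterUp f h b))
                                       (antidiagonal-shiftˡ s (λ f b → paths f h b) fl (λ b → refl) (λ f b → refl)))
                            (down h))
                 (antidiagonal-shiftʳ s (λ f b → paths f (suc h) b) up (λ f → refl) (λ f b → refl)) ⟩
  0 + pathsOfSize s h + pathsDownFirst s h + pathsOfSize s (suc h) ∎
  where
  open ≡-Reasoning
  e = λ f b → emptyPath f h b
  fl = λ f b → flatFirst f h b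
  dn = λ f b → downFirst f h b
  up = λ f b → upFirst f h b
  down : ∀ h → antidiagonal (suc s) (λ f b → downFirst f h b) ≡ pathsDownFirst s h
  down zero    = antidiagonal-zero (suc s) _ (λ _ _ → refl)
  down (suc h) = refl

pathsOfSize-schroeder : ∀ m → pathsOfSize m 0 ≡ schroeder m
pathsOfSize-schroeder m = begin
  pathsOfSize m 0
    ≡⟨ antidiagonal≡sum m (λ f b → paths f 0 b) ⟩
  sum (applyUpTo (λ b → paths (m ∸ b) 0 b) (suc m))
    ≡⟨ cong sum (applyUpTo-cong (suc m) (λ b b<m → term b (≤-pred b<m))) ⟩
  sum (applyUpTo (λ k → ((m + k) C (m ∸ k)) * catalan k) (suc m))
    ≡⟨ cong sum (map-applyUpTo id (λ k → ((m + k) C (m ∸ k)) * catalan k) (suc m)) ⟨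
  schroeder m ∎
  where
  open ≡-Reasoning
  term : ∀ b → b ≤ m → paths (m ∸ b) 0 b ≡ ((m + b) C (m ∸ b)) * catalan b
  term b b≤m = trans (paths-interleave (m ∸ b) 0 b) (cong₂ (λ x y → (x C (m ∸ b)) * y) length-eq (sym (catalan≡dyckPaths b)))
    where length-eq : (m ∸ b) + (0 + (b + b)) ≡ m + b
          length-eq = trans (sym (+-assoc (m ∸ b) b b)) (cong (_+ b) (m∸n+n≡m b≤m))
  applyUpTo-cong : ∀ n {F G : ℕ → ℕ} → (∀ b → b < n → F b ≡ G b) → applyUpTo F n ≡ applyUpTo G n
  applyUpTo-cong zero    e = refl
  applyUpTo-cong (suc n) e = cong₂ _∷_ (e 0 z<s) (applyUpTo-cong n (λ b lt → e (suc b) (s<s lt)))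

-- The generating tree

sumBelow : ℕ → (ℕ → ℕ) → ℕ
sumBelow zero    f = 0
sumBelow (suc n) f = sumBelow n f + f n

sumBelow-suc : ∀ n f → sumBelow (suc n) f ≡ f 0 + sumBelow n (f ∘ suc)
sumBelow-suc zero    f = +-comm 0 (f 0)
sumBelow-suc (suc n) f = trans (cong (_+ f (suc n)) (sumBelow-suc n f)) (+-assoc (f 0) _ _)

sumBelow-cong : ∀ n {f g} → (∀ i → f i ≡ g i) → sumBelow n f ≡ sumBelow n g
sumBelow-cong zero    e = refl
sumBelow-cong (suc n) e = cong₂ _+_ (sumBelow-cong n e) (e n)

-- The number of multisets of size h drawn from j kinds.
multichoose : ℕ → ℕ → ℕ
multichoose zero    j       = 1
multichoose (suc h) zero    = 0
multichoose (suc h) (suc j) = multichoose (suc h) j + multichoose h (suc j)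

sumBelow-multichoose-size : ∀ u j → sumBelow (suc u) (λ h → multichoose h j) ≡ multichoose u (suc j)
sumBelow-multichoose-size zero    j = refl
sumBelow-multichoose-size (suc u) j =
  trans (cong (_+ multichoose (suc u) j) (sumBelow-multichoose-size u j)) (+-comm (multichoose u (suc j)) _)

sumBelow-multichoose-kinds : ∀ u m → sumBelow m (λ k → multichoose u (suc k)) ≡ multichoose (suc u) m
sumBelow-multichoose-kinds u zero    = refl
sumBelow-multichoose-kinds u (suc m) = cong (_+ multichoose u (suc m)) (sumBelow-multichoose-kinds u m)

weightedSum : List ℕ → (ℕ → ℕ) → ℕ
weightedSum []      c = 0
weightedSum (x ∷ v) c = x * c 0 + weightedSum v (c ∘ suc)

weightedSum-cong : ∀ v {c d} → (∀ i → c i ≡ d i) → weightedSum v c ≡ weightedSum v d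
weightedSum-cong []      e = refl
weightedSum-cong (x ∷ v) e = cong₂ _+_ (cong (x *_) (e 0)) (weightedSum-cong v (e ∘ suc))

weightedSum-+ : ∀ v c d → weightedSum v (λ i → c i + d i) ≡ weightedSum v c + weightedSum v d
weightedSum-+ []      c d = refl
weightedSum-+ (x ∷ v) c d =
  trans (cong₂ _+_ (*-distribˡ-+ x (c 0) (d 0)) (weightedSum-+ v (c ∘ suc) (d ∘ suc))) (exchange (x * c 0) (x * d 0) _ _)
  where exchange : ∀ a b p q → a + b + (p + q) ≡ a + p + (b + q)
        exchange = solve-∀

weightedSum-const : ∀ v a → weightedSum v (λ _ → a) ≡ a * sum v
weightedSum-const []      a = sym (*-zeroʳ a)
weightedSum-const (x ∷ v) a = begin
  x * a + weightedSum v (λ _ → a) ≡⟨ cong₂ _+_ (*-comm x a) (weightedSum-const v a) ⟩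
  a * x + a * sum v               ≡⟨ *-distribˡ-+ a x (sum v) ⟨
  a * (x + sum v)                 ∎
  where open ≡-Reasoning

weightedSum-zero : ∀ v c → (∀ i → c i ≡ 0) → weightedSum v c ≡ 0
weightedSum-zero []      c e = refl
weightedSum-zero (x ∷ v) c e =
  cong₂ _+_ (trans (cong (x *_) (e 0)) (*-zeroʳ x)) (weightedSum-zero v (c ∘ suc) (e ∘ suc))

weightedSum-sumBelow : ∀ v m (c : ℕ → ℕ → ℕ) →
  weightedSum v (λ i → sumBelow m (λ k → c k i)) ≡ sumBelow m (λ k → weightedSum v (c k))
weightedSum-sumBelow v zero    c = weightedSum-zero v _ (λ _ → refl)
weightedSum-sumBelow v (suc m) c = trans (weightedSum-+ v _ _) (cong (_+ weightedSum v (c m)) (weightedSum-sumBelow v m c))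

suffixSums : List ℕ → List ℕ
suffixSums []      = []
suffixSums (x ∷ v) = (x + sum v) ∷ suffixSums v

-- addShifted v p is v plus (p ∷ v), the shorter list padded by 0.
addShifted : List ℕ → ℕ → List ℕ
addShifted []      p = p ∷ []
addShifted (x ∷ v) p = (x + p) ∷ addShifted v x

head₀ : List ℕ → ℕ
head₀ []      = 0
head₀ (x ∷ _) = x

head₀-suffixSums : ∀ v → head₀ (suffixSums v) ≡ sum v
head₀-suffixSums []      = refl
head₀-suffixSums (x ∷ v) = refl

weightedSum-suffixSums : ∀ v c → weightedSum (suffixSums v) c ≡ weightedSum v (λ u → sumBelow (suc u) c)
weightedSum-suffixSums []      c = refl
weightedSum-suffixSums (x ∷ v) c = begin
  (x + sum v) * c 0 + weightedSum (suffixSums v) (c ∘ suc)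
    ≡⟨ cong ((x + sum v) * c 0 +_) (weightedSum-suffixSums v (c ∘ suc)) ⟩
  (x + sum v) * c 0 + weightedSum v (λ u → sumBelow (suc u) (c ∘ suc))
    ≡⟨ rearrange x (sum v) (c 0) _ ⟩
  x * c 0 + (c 0 * sum v + weightedSum v (λ u → sumBelow (suc u) (c ∘ suc)))
    ≡⟨ cong (λ w → x * c 0 + (w + weightedSum v (λ u → sumBelow (suc u) (c ∘ suc)))) (weightedSum-const v (c 0)) ⟨
  x * c 0 + (weightedSum v (λ _ → c 0) + weightedSum v (λ u → sumBelow (suc u) (c ∘ suc)))
    ≡⟨ cong (x * c 0 +_) (weightedSum-+ v _ _) ⟨
  x * c 0 + weightedSum v (λ u → c 0 + sumBelow (suc u) (c ∘ suc))
    ≡⟨ cong (x * c 0 +_) (weightedSum-cong v (λ u → sumBelow-suc (suc u) c)) ⟨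
  x * c 0 + weightedSum v (λ u → sumBelow (suc (suc u)) c)
    ≡⟨ cong (_+ weightedSum v (λ u → sumBelow (suc (suc u)) c)) (cong (x *_) (+-identityˡ (c 0))) ⟨
  x * (0 + c 0) + weightedSum v (λ u → sumBelow (suc (suc u)) c) ∎
  where open ≡-Reasoning
        rearrange : ∀ x s a q → (x + s) * a + q ≡ x * a + (a * s + q)
        rearrange = solve-∀

weightedSum-addShifted : ∀ v p c → weightedSum (addShifted v p) c ≡ p * c 0 + weightedSum v c + weightedSum v (c ∘ suc)
weightedSum-addShifted []      p c = trans (+-identityʳ _) (sym (trans (+-identityʳ _) (+-identityʳ _)))
weightedSum-addShifted (x ∷ v) p c =
  trans (cong ((x + p) * c 0 +_) (weightedSum-addShifted v x (c ∘ suc)))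
        (rearrange x p (c 0) (c 1) (weightedSum v (c ∘ suc)) (weightedSum v (c ∘ suc ∘ suc)))
  where rearrange : ∀ x p a b q w → (x + p) * a + (x * b + q + w) ≡ p * a + (x * a + q) + (x * b + w)
        rearrange = solve-∀

sizeRow : ℕ → ℕ → List ℕ
sizeRow zero    h = pathsOfSize 0 h ∷ []
sizeRow (suc s) h = pathsOfSize (suc s) h ∷ sizeRow s (suc h)

sizeRow-suc : ∀ s h → sizeRow (suc s) h ≡ suffixSums (addShifted (sizeRow s h) (pathsDownFirst s h))
sizeRow-suc zero h = cong₂ _∷_ first (cong (_∷ []) second)
  where
  second : pathsOfSize 0 (suc h) ≡ pathsOfSize 0 h + 0
  second = trans (paths-descent (suc h)) (sym (trans (+-identityʳ _) (paths-descent h)))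
  first : pathsOfSize 1 h ≡ pathsOfSize 0 h + pathsDownFirst 0 h + (pathsOfSize 0 h + 0)
  first = trans (pathsOfSize-suc 0 h) (cong (pathsOfSize 0 h + pathsDownFirst 0 h +_) second)
sizeRow-suc (suc s) h = cong₂ _∷_ first rest
  where
  shifted = addShifted (sizeRow s (suc h)) (pathsOfSize (suc s) h)
  rest : sizeRow (suc s) (suc h) ≡ suffixSums shifted
  rest = sizeRow-suc s (suc h)
  total : sum shifted ≡ pathsOfSize (suc s) (suc h)
  total = trans (sym (head₀-suffixSums shifted)) (cong head₀ (sym rest))
  first : pathsOfSize (suc (suc s)) h ≡ pathsOfSize (suc s) h + pathsDownFirst (suc s) h + sum shifted
  first = trans (pathsOfSize-suc (suc s) h) (cong (pathsOfSize (suc s) h + pathsDownFirst (suc s) h +_) (sym total))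

-- In the generating tree a node labelled L has L + 1 children, labelled L+1, 2, 3, …, L+1.
childLabel : ℕ → ℕ → ℕ
childLabel zero    L = suc L
childLabel (suc k) L = suc (suc k)

sumOverChildren : (ℕ → ℕ) → ℕ → ℕ
sumOverChildren g L = sumBelow (suc L) (λ k → g (childLabel k L))

descendants : ℕ → ℕ → ℕ
descendants zero    L = 1
descendants (suc d) L = sumOverChildren (descendants d) L

-- Both sides satisfy the same recursion in d: sizeRow-suc on the rows, and the
-- hockey-stick identities for multichoose on the weights.
descendants-weightedSum : ∀ d j → descendants d (suc j) ≡ weightedSum (sizeRow d 0) (λ h → multichoose h j)
descendants-weightedSum zero    j = refl
descendants-weightedSum (suc d) j = begin
  sumOverChildren (descendants d) (suc j)
    ≡⟨ sumBelow-suc (suc j) _ ⟩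
  descendants d (suc (suc j)) + sumBelow (suc j) (λ k → descendants d (suc (suc k)))
    ≡⟨ cong₂ _+_ (descendants-weightedSum d (suc j)) (sumBelow-cong (suc j) (λ k → descendants-weightedSum d (suc k))) ⟩
  weightedSum R (λ h → multichoose h (suc j)) + sumBelow (suc j) (λ k → weightedSum R (λ h → multichoose h (suc k)))
    ≡⟨ cong (weightedSum R (λ h → multichoose h (suc j)) +_) (weightedSum-sumBelow R (suc j) (λ k h → multichoose h (suc k))) ⟨
  weightedSum R (λ h → multichoose h (suc j)) + weightedSum R (λ u → sumBelow (suc j) (λ k → multichoose u (suc k)))
    ≡⟨ cong₂ _+_ (weightedSum-cong R (λ u → sym (sumBelow-multichoose-size u j)))
                 (weightedSum-cong R (λ u → trans (sumBelow-multichoose-kinds u (suc j)) (sym (sumBelow-multichoose-size (suc u) j)))) ⟩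
  weightedSum R (λ u → sumBelow (suc u) c) + weightedSum R (λ u → sumBelow (suc (suc u)) c)
    ≡⟨ weightedSum-addShifted R 0 (λ u → sumBelow (suc u) c) ⟨
  weightedSum (addShifted R 0) (λ u → sumBelow (suc u) c)
    ≡⟨ weightedSum-suffixSums (addShifted R 0) c ⟨
  weightedSum (suffixSums (addShifted R 0)) c
    ≡⟨ cong (λ w → weightedSum w c) (sizeRow-suc d 0) ⟨
  weightedSum (sizeRow (suc d) 0) c ∎
  where open ≡-Reasoning
        R = sizeRow d 0
        c = λ h → multichoose h j

descendants-one : ∀ m → descendants m 1 ≡ pathsOfSize m 0
descendants-one m = trans (descendants-weightedSum m 0) (headOnly m)
  where
  headOnly : ∀ m → weightedSum (sizeRow m 0) (λ h → multichoose h 0) ≡ pathsOfSize m 0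
  headOnly zero    = trans (+-identityʳ _) (*-identityʳ _)
  headOnly (suc m) = trans (cong₂ _+_ (*-identityʳ _) (weightedSum-zero (sizeRow m 1) _ (λ _ → refl))) (+-identityʳ _)

descendants-schroeder : ∀ m → descendants m 1 ≡ schroeder m
descendants-schroeder m = trans (descendants-one m) (pathsOfSize-schroeder m)

-- Occurrences of 132 and 231

<ᵇ-true : ∀ {a b} → a < b → (a <ᵇ b) ≡ true
<ᵇ-true a<b = Equivalence.to T-≡ (<⇒<ᵇ a<b)

<ᵇ-sound : ∀ a b → (a <ᵇ b) ≡ true → a < b
<ᵇ-sound a b e = <ᵇ⇒< a b (Equivalence.from T-≡ e)

<ᵇ-false : ∀ {a b} → b ≤ a → (a <ᵇ b) ≡ false
<ᵇ-false {a} {b} b≤a = ¬-not (λ e → <⇒≱ (<ᵇ-sound a b e) b≤a)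

≡ᵇ-refl : ∀ a → (a ≡ᵇ a) ≡ true
≡ᵇ-refl a = Equivalence.to T-≡ (≡⇒≡ᵇ a a refl)

≡ᵇ-sound : ∀ a b → (a ≡ᵇ b) ≡ true → a ≡ b
≡ᵇ-sound a b e = ≡ᵇ⇒≡ a b (Equivalence.from T-≡ e)

≡ᵇ-false : ∀ {a b} → a ≢ b → (a ≡ᵇ b) ≡ false
≡ᵇ-false {a} {b} a≢b = ¬-not (a≢b ∘ ≡ᵇ-sound a b)

∨-true : ∀ a b → a ∨ b ≡ true → a ≡ true ⊎ b ≡ true
∨-true true  b e = inj₁ refl
∨-true false b e = inj₂ e

∧-true : ∀ a b → a ∧ b ≡ true → a ≡ true × b ≡ true
∧-true true b e = refl , e

any-++ : ∀ {A : Set} (p : A → Bool) xs ys → any p (xs ++ ys) ≡ any p xs ∨ any p ys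
any-++ p []       ys = refl
any-++ p (x ∷ xs) ys = trans (cong (p x ∨_) (any-++ p xs ys)) (sym (∨-assoc (p x) _ _))

any-map : ∀ {A B : Set} (p : B → Bool) (f : A → B) xs → any p (map f xs) ≡ any (p ∘ f) xs
any-map p f []       = refl
any-map p f (x ∷ xs) = cong (p (f x) ∨_) (any-map p f xs)

any-cong : ∀ {A : Set} {p q : A → Bool} xs → (∀ x → p x ≡ q x) → any p xs ≡ any q xs
any-cong []       e = refl
any-cong (x ∷ xs) e = cong₂ _∨_ (e x) (any-cong xs e)

any-false : ∀ {A : Set} (p : A → Bool) xs → (∀ x → p x ≡ false) → any p xs ≡ false
any-false p []       e = refl
any-false p (x ∷ xs) e = cong₂ _∨_ (e x) (any-false p xs e)

any-subseqs-∷ : ∀ (g : List ℕ → Bool) x w →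
  any g (subseqs (x ∷ w)) ≡ any (g ∘ (x ∷_)) (subseqs w) ∨ any g (subseqs w)
any-subseqs-∷ g x w =
  trans (any-++ g (map (x ∷_) (subseqs w)) (subseqs w)) (cong (_∨ any g (subseqs w)) (any-map g (x ∷_) (subseqs w)))

any-subseqs-empty : ∀ (h : List ℕ → Bool) → (∀ x s → h (x ∷ s) ≡ false) → ∀ w → any h (subseqs w) ≡ h []
any-subseqs-empty h e []      = ∨-identityʳ (h [])
any-subseqs-empty h e (c ∷ w) =
  trans (any-subseqs-∷ h c w) (cong₂ _∨_ (any-false _ (subseqs w) (e c)) (any-subseqs-empty h e w))

any-subseqs-singletons : ∀ (h : List ℕ → Bool) → h [] ≡ false → (∀ x y s → h (x ∷ y ∷ s) ≡ false) →
  ∀ w → any h (subseqs w) ≡ any (λ c → h (c ∷ [])) w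
any-subseqs-singletons h e₀ e₂ []      = trans (∨-identityʳ (h [])) e₀
any-subseqs-singletons h e₀ e₂ (c ∷ w) = trans (any-subseqs-∷ h c w)
  (cong₂ _∨_ (any-subseqs-empty (h ∘ (c ∷_)) (e₂ c) w) (any-subseqs-singletons h e₀ e₂ w))

any-subseqs-pairs : ∀ (h : List ℕ → Bool) → h [] ≡ false → (∀ x → h (x ∷ []) ≡ false) →
  (∀ x y z s → h (x ∷ y ∷ z ∷ s) ≡ false) →
  ∀ w → any h (subseqs w) ≡ any (λ p → h (proj₁ p ∷ proj₂ p ∷ [])) (pairs w)
any-subseqs-pairs h e₀ e₁ e₃ []      = trans (∨-identityʳ (h [])) e₀
any-subseqs-pairs h e₀ e₁ e₃ (b ∷ w) = begin
  any h (subseqs (b ∷ w))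
    ≡⟨ any-subseqs-∷ h b w ⟩
  any (h ∘ (b ∷_)) (subseqs w) ∨ any h (subseqs w)
    ≡⟨ cong₂ _∨_ (any-subseqs-singletons (h ∘ (b ∷_)) (e₁ b) (e₃ b) w) (any-subseqs-pairs h e₀ e₁ e₃ w) ⟩
  any (λ c → h (b ∷ c ∷ [])) w ∨ any h′ (pairs w)
    ≡⟨ cong (_∨ any h′ (pairs w)) (any-map h′ (b ,_) w) ⟨
  any h′ (map (b ,_) w) ∨ any h′ (pairs w)
    ≡⟨ any-++ h′ (map (b ,_) w) (pairs w) ⟨
  any h′ (pairs (b ∷ w)) ∎
  where open ≡-Reasoning
        h′ = λ (p : ℕ × ℕ) → h (proj₁ p ∷ proj₂ p ∷ [])

data Comparison : Bool → Bool → Bool → Set where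
  less    : Comparison true  false false
  equal   : Comparison false true  false
  greater : Comparison false false true

compareᵇ : ∀ x y → Comparison (x <ᵇ y) (x ≡ᵇ y) (y <ᵇ x)
compareᵇ zero    zero    = equal
compareᵇ zero    (suc y) = less
compareᵇ (suc x) zero    = greater
compareᵇ (suc x) (suc y) = compareᵇ x y

peakPatterns : List (List ℕ)
peakPatterns = p132 ∷ p231 ∷ []

classical : List (List ℕ)
classical = p21 ∷ []

-- An occurrence of 132 or 231 is a triple a b c (in this order) with a < b > c and a ≠ c.
peakAt : ℕ → ℕ → ℕ → Bool
peakAt a b c = (a <ᵇ b) ∧ (c <ᵇ b) ∧ not (a ≡ᵇ c)

peakPatterns-triple : ∀ a b c → any (orderIso (a ∷ b ∷ c ∷ [])) peakPatterns ≡ peakAt a b c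
peakPatterns-triple a b c with a <ᵇ b | a ≡ᵇ b | b <ᵇ a | compareᵇ a b
... | _ | _ | _ | equal   = refl
... | _ | _ | _ | greater = refl
... | _ | _ | _ | less with a <ᵇ c | a ≡ᵇ c | c <ᵇ a | compareᵇ a c | b <ᵇ c | b ≡ᵇ c | c <ᵇ b | compareᵇ b c
...   | _ | _ | _ | less    | _ | _ | _ | less    = refl
...   | _ | _ | _ | equal   | _ | _ | _ | less    = refl
...   | _ | _ | _ | greater | _ | _ | _ | less    = refl
...   | _ | _ | _ | less    | _ | _ | _ | equal   = refl
...   | _ | _ | _ | equal   | _ | _ | _ | equal   = refl
...   | _ | _ | _ | greater | _ | _ | _ | equal   = refl
...   | _ | _ | _ | less    | _ | _ | _ | greater = refl
...   | _ | _ | _ | equal   | _ | _ | _ | greater = refl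
...   | _ | _ | _ | greater | _ | _ | _ | greater = refl

peakFrom : ℕ → ℕ × ℕ → Bool
peakFrom a p = peakAt a (proj₁ p) (proj₂ p)

hasPeak : List ℕ → Bool
hasPeak []      = false
hasPeak (a ∷ w) = any (peakFrom a) (pairs w) ∨ hasPeak w

containsSome-peakPatterns : ∀ w → containsSome peakPatterns w ≡ hasPeak w
containsSome-peakPatterns []      = refl
containsSome-peakPatterns (a ∷ w) = trans (any-subseqs-∷ _ a w) (cong₂ _∨_
  (trans (any-subseqs-pairs _ refl (λ _ → refl) (λ _ _ _ _ → refl) w)
         (any-cong (pairs w) (λ p → peakPatterns-triple a (proj₁ p) (proj₂ p))))
  (containsSome-peakPatterns w))

classical-pair : ∀ a b → any (orderIso (a ∷ b ∷ [])) classical ≡ (b <ᵇ a)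
classical-pair a b with a <ᵇ b | a ≡ᵇ b | b <ᵇ a | compareᵇ a b
... | _ | _ | _ | less    = refl
... | _ | _ | _ | equal   = refl
... | _ | _ | _ | greater = refl

hasInversion : List ℕ → Bool
hasInversion []      = false
hasInversion (a ∷ w) = any (_<ᵇ a) w ∨ hasInversion w

containsSome-classical : ∀ w → containsSome classical w ≡ hasInversion w
containsSome-classical []      = refl
containsSome-classical (a ∷ w) = trans (any-subseqs-∷ _ a w) (cong₂ _∨_
  (trans (any-subseqs-singletons _ refl (λ _ _ _ → refl) w) (any-cong w (classical-pair a)))
  (containsSome-classical w))

-- The greedy stacks

popUntil-stop : ∀ Ts x s → containsSome Ts (x ∷ s) ≡ false → popUntil Ts x s ≡ ([] , s)
popUntil-stop Ts x s e with containsSome Ts (x ∷ s)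
popUntil-stop Ts x s refl | false = refl

popUntil-pop : ∀ Ts x y s → containsSome Ts (x ∷ y ∷ s) ≡ true →
  popUntil Ts x (y ∷ s) ≡ (y ∷ proj₁ (popUntil Ts x s) , proj₂ (popUntil Ts x s))
popUntil-pop Ts x y s e with containsSome Ts (x ∷ y ∷ s)
popUntil-pop Ts x y s refl | true with popUntil Ts x s
... | (o , r) = refl

popUntil-split : ∀ Ts x s → proj₁ (popUntil Ts x s) ++ proj₂ (popUntil Ts x s) ≡ s
popUntil-split Ts x s with containsSome Ts (x ∷ s)
popUntil-split Ts x s       | false = refl
popUntil-split Ts x []      | true  = refl
popUntil-split Ts x (y ∷ s) | true with popUntil Ts x s | popUntil-split Ts x s
... | (o , r) | e = cong (y ∷_) e

popUntil-avoids : ∀ Ts x s → containsSome Ts (x ∷ []) ≡ false → containsSome Ts (x ∷ proj₂ (popUntil Ts x s)) ≡ false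
popUntil-avoids Ts x s h₁ with containsSome Ts (x ∷ s) in eq
popUntil-avoids Ts x s       h₁ | false = eq
popUntil-avoids Ts x []      h₁ | true  = h₁
popUntil-avoids Ts x (y ∷ s) h₁ | true with popUntil Ts x s | popUntil-avoids Ts x s h₁
... | (o , r) | e = e

tStackRun-∷ : ∀ Ts x xs s →
  tStackRun Ts (x ∷ xs) s ≡ proj₁ (popUntil Ts x s) ++ tStackRun Ts xs (x ∷ proj₂ (popUntil Ts x s))
tStackRun-∷ Ts x xs s with popUntil Ts x s
... | (o , r) = refl

runPrefix : List (List ℕ) → List ℕ → List ℕ → List ℕ × List ℕ
runPrefix Ts []       s = ([] , s)
runPrefix Ts (x ∷ xs) s =
  proj₁ (popUntil Ts x s) ++ proj₁ (runPrefix Ts xs (x ∷ proj₂ (popUntil Ts x s))) ,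
  proj₂ (runPrefix Ts xs (x ∷ proj₂ (popUntil Ts x s)))

tStackRun-++ : ∀ Ts xs ys s →
  tStackRun Ts (xs ++ ys) s ≡ proj₁ (runPrefix Ts xs s) ++ tStackRun Ts ys (proj₂ (runPrefix Ts xs s))
tStackRun-++ Ts []       ys s = refl
tStackRun-++ Ts (x ∷ xs) ys s = trans (tStackRun-∷ Ts x (xs ++ ys) s)
  (trans (cong (proj₁ (popUntil Ts x s) ++_) (tStackRun-++ Ts xs ys (x ∷ proj₂ (popUntil Ts x s))))
         (sym (++-assoc (proj₁ (popUntil Ts x s)) _ _)))

tStackRun-flush : ∀ Ts xs s → tStackRun Ts xs s ≡ proj₁ (runPrefix Ts xs s) ++ proj₂ (runPrefix Ts xs s)
tStackRun-flush Ts xs s = trans (cong (λ l → tStackRun Ts l s) (sym (++-identityʳ xs))) (tStackRun-++ Ts xs [] s)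

occ-++ : ∀ y l₁ l₂ → occ y (l₁ ++ l₂) ≡ occ y l₁ + occ y l₂
occ-++ y []       l₂ = refl
occ-++ y (x ∷ l₁) l₂ =
  trans (cong ((if y ≡ᵇ x then 1 else 0) +_) (occ-++ y l₁ l₂)) (sym (+-assoc (if y ≡ᵇ x then 1 else 0) (occ y l₁) (occ y l₂)))

occ-popUntil : ∀ Ts x s y → occ y (proj₁ (popUntil Ts x s)) + occ y (proj₂ (popUntil Ts x s)) ≡ occ y s
occ-popUntil Ts x s y =
  trans (sym (occ-++ y (proj₁ (popUntil Ts x s)) (proj₂ (popUntil Ts x s)))) (cong (occ y) (popUntil-split Ts x s))

occ-runPrefix : ∀ Ts xs s y →
  occ y (proj₁ (runPrefix Ts xs s)) + occ y (proj₂ (runPrefix Ts xs s)) ≡ occ y xs + occ y s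
occ-runPrefix Ts []       s y = refl
occ-runPrefix Ts (x ∷ xs) s y = begin
  occ y (o ++ o₂) + occ y s₂                 ≡⟨ cong (_+ occ y s₂) (occ-++ y o o₂) ⟩
  occ y o + occ y o₂ + occ y s₂              ≡⟨ +-assoc (occ y o) _ _ ⟩
  occ y o + (occ y o₂ + occ y s₂)            ≡⟨ cong (occ y o +_) (occ-runPrefix Ts xs (x ∷ r) y) ⟩
  occ y o + (occ y xs + (ix + occ y r))      ≡⟨ rearrange (occ y o) (occ y xs) ix (occ y r) ⟩
  ix + occ y xs + (occ y o + occ y r)        ≡⟨ cong (ix + occ y xs +_) (occ-popUntil Ts x s y) ⟩
  ix + occ y xs + occ y s                    ∎
  where open ≡-Reasoning
        o = proj₁ (popUntil Ts x s)
        r = proj₂ (popUntil Ts x s)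
        o₂ = proj₁ (runPrefix Ts xs (x ∷ r))
        s₂ = proj₂ (runPrefix Ts xs (x ∷ r))
        ix = if y ≡ᵇ x then 1 else 0
        rearrange : ∀ a b c d → a + (b + (c + d)) ≡ c + b + (a + d)
        rearrange = solve-∀

occ-tStackRun : ∀ Ts xs s y → occ y (tStackRun Ts xs s) ≡ occ y xs + occ y s
occ-tStackRun Ts xs s y = trans (cong (occ y) (tStackRun-flush Ts xs s))
  (trans (occ-++ y (proj₁ (runPrefix Ts xs s)) (proj₂ (runPrefix Ts xs s))) (occ-runPrefix Ts xs s y))

occ-self : ∀ a l → 0 < occ a (a ∷ l)
occ-self a l rewrite ≡ᵇ-refl a = s≤s z≤n

occ-≤-∷ : ∀ y x l → occ y l ≤ occ y (x ∷ l)
occ-≤-∷ y x l = m≤n+m (occ y l) _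

occ-≤-++ˡ : ∀ y u v → occ y u ≤ occ y (u ++ v)
occ-≤-++ˡ y u v = subst (occ y u ≤_) (sym (occ-++ y u v)) (m≤m+n _ _)

occ-≤-++ʳ : ∀ y u v → occ y v ≤ occ y (u ++ v)
occ-≤-++ʳ y u v = subst (occ y v ≤_) (sym (occ-++ y u v)) (m≤n+m _ _)

occ-++-∷ : ∀ y a u v → occ y (u ++ a ∷ v) ≡ occ y (a ∷ u ++ v)
occ-++-∷ y a []      v = refl
occ-++-∷ y a (x ∷ u) v = trans (cong (ix +_) (occ-++-∷ y a u v)) (swap ix (if y ≡ᵇ a then 1 else 0) (occ y (u ++ v)))
  where ix = if y ≡ᵇ x then 1 else 0
        swap : ∀ a b c → a + (b + c) ≡ b + (a + c)
        swap a b c = trans (sym (+-assoc a b c)) (trans (cong (_+ c) (+-comm a b)) (+-assoc b a c))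

occ-++-monoʳ : ∀ y u {v w} → occ y v ≤ occ y w → occ y (u ++ v) ≤ occ y (u ++ w)
occ-++-monoʳ y u {v} {w} le = subst₂ _≤_ (sym (occ-++ y u v)) (sym (occ-++ y u w)) (+-monoʳ-≤ (occ y u) le)

occ-remaining-≤ : ∀ Ts x s y → occ y (proj₂ (popUntil Ts x s)) ≤ occ y s
occ-remaining-≤ Ts x s y = subst (occ y (proj₂ (popUntil Ts x s)) ≤_) (occ-popUntil Ts x s y) (m≤n+m _ _)

occ-stack-≤ : ∀ Ts xs y → occ y (proj₂ (runPrefix Ts xs [])) ≤ occ y xs
occ-stack-≤ Ts xs y =
  subst (occ y (proj₂ (runPrefix Ts xs [])) ≤_) (trans (occ-runPrefix Ts xs [] y) (+-identityʳ _)) (m≤n+m _ _)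

occ-output-≤ : ∀ Ts xs y → occ y (proj₁ (runPrefix Ts xs [])) ≤ occ y xs
occ-output-≤ Ts xs y =
  subst (occ y (proj₁ (runPrefix Ts xs [])) ≤_) (trans (occ-runPrefix Ts xs [] y) (+-identityʳ _)) (m≤m+n _ _)

record Below (N : ℕ) (l : List ℕ) : Set where
  constructor mkBelow
  field below : ∀ y → 0 < occ y l → y < N
open Below public

below-head : ∀ {N a l} → Below N (a ∷ l) → a < N
below-head {N} {a} {l} b = below b a (occ-self a l)

below-sub : ∀ {N l l'} → (∀ y → occ y l' ≤ occ y l) → Below N l → Below N l'
below-sub le b = mkBelow λ y p → below b y (≤-trans p (le y))

below-tail : ∀ {N a l} → Below N (a ∷ l) → Below N l
below-tail {a = a} {l} = below-sub (λ y → occ-≤-∷ y a l)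

below-∷ : ∀ {N a l} → a < N → Below N l → Below N (a ∷ l)
below-∷ {N} {a} {l} a<N b = mkBelow f
  where f : ∀ y → 0 < occ y (a ∷ l) → y < N
        f y p with y ≡ᵇ a in e
        ... | true  = subst (_< N) (sym (≡ᵇ-sound y a e)) a<N
        ... | false = below b y p

below-[] : ∀ N → Below N []
below-[] N = mkBelow λ y ()

below-++ˡ : ∀ {N} u v → Below N (u ++ v) → Below N u
below-++ˡ u v = below-sub (λ y → occ-≤-++ˡ y u v)

below-++ʳ : ∀ {N} u v → Below N (u ++ v) → Below N v
below-++ʳ u v = below-sub (λ y → occ-≤-++ʳ y u v)

below-+ : ∀ {N} l u v → (∀ y → occ y l ≡ occ y u + occ y v) → Below N u → Below N v → Below N l
below-+ {N} l u v split bu bv = mkBelow λ y p → case y (subst (0 <_) (split y) p)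
  where case : ∀ y → 0 < occ y u + occ y v → y < N
        case y p with occ y u in e
        ... | zero  = below bv y p
        ... | suc k = below bu y (subst (0 <_) (sym e) (s≤s z≤n))

below-remaining : ∀ {N} Ts x s → Below N s → Below N (proj₂ (popUntil Ts x s))
below-remaining Ts x s = below-sub (occ-remaining-≤ Ts x s)

below-stack : ∀ {N} Ts u → Below N u → Below N (proj₂ (runPrefix Ts u []))
below-stack Ts u = below-sub (occ-stack-≤ Ts u)

below-tStackRun : ∀ {N} Ts u s → Below N u → Below N s → Below N (tStackRun Ts u s)
below-tStackRun Ts u s = below-+ (tStackRun Ts u s) u s (occ-tStackRun Ts u s)

record Distinct (l : List ℕ) : Set where
  constructor mkDistinct
  field distinct : ∀ y → occ y l ≤ 1
open Distinct public

distinct-sub : ∀ {l l'} → (∀ y → occ y l' ≤ occ y l) → Distinct l → Distinct l'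
distinct-sub le d = mkDistinct λ y → ≤-trans (le y) (distinct d y)

distinct-head : ∀ {a l} → Distinct (a ∷ l) → occ a l ≡ 0
distinct-head {a} {l} d = n≤0⇒n≡0 (+-cancelˡ-≤ 1 _ _ (subst (λ i → i + occ a l ≤ 1) (cong (if_then 1 else 0) (≡ᵇ-refl a)) (distinct d a)))

distinct-disjoint : ∀ u v y z → Distinct (u ++ v) → 0 < occ y u → 0 < occ z v → y ≢ z
distinct-disjoint u v y z d p q refl =
  1+n≰n (≤-trans (+-mono-≤ p q) (subst (_≤ 1) (occ-++ y u v) (distinct d y)))

-- A maximum on the stack

any-pairs-∷ʳ : ∀ (f : ℕ × ℕ → Bool) N w → (∀ b → 0 < occ b w → f (b , N) ≡ false) →
  any f (pairs (w ++ [ N ])) ≡ any f (pairs w)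
any-pairs-∷ʳ f N []      h = refl
any-pairs-∷ʳ f N (x ∷ w) h = begin
  any f (map (x ,_) (w ++ [ N ]) ++ pairs (w ++ [ N ]))
    ≡⟨ any-++ f (map (x ,_) (w ++ [ N ])) (pairs (w ++ [ N ])) ⟩
  any f (map (x ,_) (w ++ [ N ])) ∨ any f (pairs (w ++ [ N ]))
    ≡⟨ cong₂ _∨_ (trans (any-map f (x ,_) (w ++ [ N ])) (any-++ _ w [ N ]))
                 (any-pairs-∷ʳ f N w (λ b p → h b (≤-trans p (occ-≤-∷ b x w)))) ⟩
  (any (λ c → f (x , c)) w ∨ (f (x , N) ∨ false)) ∨ any f (pairs w)
    ≡⟨ cong (λ z → (any (λ c → f (x , c)) w ∨ z) ∨ any f (pairs w)) (trans (∨-identityʳ _) (h x (occ-self x w))) ⟩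
  (any (λ c → f (x , c)) w ∨ false) ∨ any f (pairs w)
    ≡⟨ cong (_∨ any f (pairs w)) (trans (∨-identityʳ _) (sym (any-map f (x ,_) w))) ⟩
  any f (map (x ,_) w) ∨ any f (pairs w)
    ≡⟨ any-++ f (map (x ,_) w) (pairs w) ⟨
  any f (map (x ,_) w ++ pairs w) ∎
  where open ≡-Reasoning

hasPeak-∷ʳ : ∀ N w → Below N w → hasPeak (w ++ [ N ]) ≡ hasPeak w
hasPeak-∷ʳ N []      b = refl
hasPeak-∷ʳ N (a ∷ w) b = cong₂ _∨_
  (any-pairs-∷ʳ (peakFrom a) N w (λ c p → trans (cong (λ z → (a <ᵇ c) ∧ (z ∧ not (a ≡ᵇ N))) (<ᵇ-false (<⇒≤ (below (below-tail b) c p)))) (∧-zeroʳ _)))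
  (hasPeak-∷ʳ N w (below-tail b))

hasInversion-∷ʳ : ∀ N w → Below N w → hasInversion (w ++ [ N ]) ≡ hasInversion w
hasInversion-∷ʳ N []      b = refl
hasInversion-∷ʳ N (a ∷ w) b = cong₂ _∨_
  (trans (any-++ _ w [ N ]) (trans (cong (any (_<ᵇ a) w ∨_) (trans (∨-identityʳ _) (<ᵇ-false (<⇒≤ (below-head b))))) (∨-identityʳ _)))
  (hasInversion-∷ʳ N w (below-tail b))

BottomBlind : List (List ℕ) → ℕ → Set
BottomBlind Ts N = ∀ y t → Below N (y ∷ t) → containsSome Ts ((y ∷ t) ++ [ N ]) ≡ containsSome Ts (y ∷ t)

peakPatterns-bottomBlind : ∀ N → BottomBlind peakPatterns N
peakPatterns-bottomBlind N y t b = begin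
  containsSome peakPatterns ((y ∷ t) ++ [ N ]) ≡⟨ containsSome-peakPatterns ((y ∷ t) ++ [ N ]) ⟩
  hasPeak ((y ∷ t) ++ [ N ])                   ≡⟨ hasPeak-∷ʳ N (y ∷ t) b ⟩
  hasPeak (y ∷ t)                              ≡⟨ containsSome-peakPatterns (y ∷ t) ⟨
  containsSome peakPatterns (y ∷ t)            ∎
  where open ≡-Reasoning

classical-bottomBlind : ∀ N → BottomBlind classical N
classical-bottomBlind N y t b = begin
  containsSome classical ((y ∷ t) ++ [ N ]) ≡⟨ containsSome-classical ((y ∷ t) ++ [ N ]) ⟩
  hasInversion ((y ∷ t) ++ [ N ])           ≡⟨ hasInversion-∷ʳ N (y ∷ t) b ⟩
  hasInversion (y ∷ t)                      ≡⟨ containsSome-classical (y ∷ t) ⟨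
  containsSome classical (y ∷ t)            ∎
  where open ≡-Reasoning

module _ (Ts : List (List ℕ)) (N : ℕ) (blind : BottomBlind Ts N)
         (singletons : ∀ y → containsSome Ts (y ∷ []) ≡ false) where

  popUntil-∷ʳ : ∀ y t → Below N (y ∷ t) →
    popUntil Ts y (t ++ [ N ]) ≡ (proj₁ (popUntil Ts y t) , proj₂ (popUntil Ts y t) ++ [ N ])
  popUntil-∷ʳ y [] b =
    trans (popUntil-stop Ts y [ N ] (trans (blind y [] b) (singletons y)))
          (cong (λ p → proj₁ p , proj₂ p ++ [ N ]) (sym (popUntil-stop Ts y [] (singletons y))))
  popUntil-∷ʳ y (z ∷ t) b = byPush (containsSome Ts (y ∷ z ∷ t)) refl
    where
    byPush : ∀ c → containsSome Ts (y ∷ z ∷ t) ≡ c →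
      popUntil Ts y (z ∷ t ++ [ N ]) ≡ (proj₁ (popUntil Ts y (z ∷ t)) , proj₂ (popUntil Ts y (z ∷ t)) ++ [ N ])
    byPush false e = trans (popUntil-stop Ts y (z ∷ t ++ [ N ]) (trans (blind y (z ∷ t) b) e))
                           (cong (λ p → proj₁ p , proj₂ p ++ [ N ]) (sym (popUntil-stop Ts y (z ∷ t) e)))
    byPush true  e = trans (popUntil-pop Ts y z (t ++ [ N ]) (trans (blind y (z ∷ t) b) e))
      (trans (cong (λ p → z ∷ proj₁ p , proj₂ p) (popUntil-∷ʳ y t (below-∷ (below-head b) (below-tail (below-tail b)))))
             (cong (λ p → proj₁ p , proj₂ p ++ [ N ]) (sym (popUntil-pop Ts y z t e))))

  tStackRun-∷ʳ : ∀ v t → Below N v → Below N t → tStackRun Ts v (t ++ [ N ]) ≡ tStackRun Ts v t ++ [ N ]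
  tStackRun-∷ʳ []      t bv bt = refl
  tStackRun-∷ʳ (y ∷ v) t bv bt = begin
    tStackRun Ts (y ∷ v) (t ++ [ N ])
      ≡⟨ tStackRun-∷ Ts y v (t ++ [ N ]) ⟩
    proj₁ (popUntil Ts y (t ++ [ N ])) ++ tStackRun Ts v (y ∷ proj₂ (popUntil Ts y (t ++ [ N ])))
      ≡⟨ cong (λ p → proj₁ p ++ tStackRun Ts v (y ∷ proj₂ p)) (popUntil-∷ʳ y t (below-∷ (below-head bv) bt)) ⟩
    o ++ tStackRun Ts v ((y ∷ r) ++ [ N ])
      ≡⟨ cong (o ++_) (tStackRun-∷ʳ v (y ∷ r) (below-tail bv) (below-∷ (below-head bv) (below-remaining Ts y t bt))) ⟩
    o ++ (tStackRun Ts v (y ∷ r) ++ [ N ])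
      ≡⟨ ++-assoc o _ _ ⟨
    (o ++ tStackRun Ts v (y ∷ r)) ++ [ N ]
      ≡⟨ cong (_++ [ N ]) (tStackRun-∷ Ts y v t) ⟨
    tStackRun Ts (y ∷ v) t ++ [ N ] ∎
    where open ≡-Reasoning
          o = proj₁ (popUntil Ts y t)
          r = proj₂ (popUntil Ts y t)

any-pairs-false : ∀ (f : ℕ × ℕ → Bool) w → (∀ b c → 0 < occ b w → f (b , c) ≡ false) → any f (pairs w) ≡ false
any-pairs-false f []      h = refl
any-pairs-false f (x ∷ w) h = trans (any-++ f (map (x ,_) w) (pairs w))
  (cong₂ _∨_ (trans (any-map f (x ,_) w) (any-false _ w (λ c → h x c (occ-self x w))))
             (any-pairs-false f w (λ b c q → h b c (≤-trans q (occ-≤-∷ b x w)))))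

any-witness : ∀ (p : ℕ → Bool) w → any p w ≡ true → ∃ λ c → 0 < occ c w × p c ≡ true
any-witness p (x ∷ w) e with ∨-true (p x) (any p w) e
... | inj₁ px = x , occ-self x w , px
... | inj₂ pw with any-witness p w pw
... | c , o , pc = c , ≤-trans o (occ-≤-∷ c x w) , pc

any-mono : ∀ (p q : ℕ → Bool) w → any p w ≡ true → (∀ c → 0 < occ c w → p c ≡ true → q c ≡ true) → any q w ≡ true
any-mono p q w e h with any-witness p w e
... | c , o , pc = true-at c w o (h c o pc)
  where
  true-at : ∀ c w → 0 < occ c w → q c ≡ true → any q w ≡ true
  true-at c (x ∷ w) o qc with c ≡ᵇ x in eq
  ... | true  = cong (_∨ any q w) (subst (λ z → q z ≡ true) (≡ᵇ-sound c x eq) qc)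
  ... | false = trans (cong (q x ∨_) (true-at c w o qc)) (∨-zeroʳ (q x))

any-pairs-mono : ∀ (f g : ℕ × ℕ → Bool) w → any f (pairs w) ≡ true →
  (∀ b c → 0 < occ b w → 0 < occ c w → f (b , c) ≡ true → g (b , c) ≡ true) → any g (pairs w) ≡ true
any-pairs-mono f g (x ∷ w) e h
  with ∨-true (any f (map (x ,_) w)) (any f (pairs w)) (trans (sym (any-++ f (map (x ,_) w) (pairs w))) e)
... | inj₁ m = trans (any-++ g (map (x ,_) w) (pairs w)) (cong (_∨ any g (pairs w)) (trans (any-map g (x ,_) w)
      (any-mono (λ c → f (x , c)) (λ c → g (x , c)) w (trans (sym (any-map f (x ,_) w)) m)
                (λ c o fc → h x c (occ-self x w) (≤-trans o (occ-≤-∷ c x w)) fc))))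
... | inj₂ m = trans (any-++ g (map (x ,_) w) (pairs w)) (trans (cong (any g (map (x ,_) w) ∨_)
      (any-pairs-mono f g w m (λ b c ob oc fbc → h b c (≤-trans ob (occ-≤-∷ b x w)) (≤-trans oc (occ-≤-∷ c x w)) fbc)))
      (∨-zeroʳ _))

peakAt-sound : ∀ a b c → peakAt a b c ≡ true → a < b × c < b × a ≢ c
peakAt-sound a b c e with ∧-true (a <ᵇ b) _ e
... | e₁ , e' with ∧-true (c <ᵇ b) _ e'
... | e₂ , e₃ = <ᵇ-sound a b e₁ , <ᵇ-sound c b e₂ , λ a≡c → true≢false (trans (sym e₃) (cong not (subst (λ z → (a ≡ᵇ z) ≡ true) a≡c (≡ᵇ-refl a))))
  where true≢false : true ≢ false
        true≢false ()

peakAt-complete : ∀ {a b c} → a < b → c < b → a ≢ c → peakAt a b c ≡ true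
peakAt-complete a<b c<b a≢c rewrite <ᵇ-true a<b | <ᵇ-true c<b | ≡ᵇ-false a≢c = refl

-- If a > s₀, a peak a b c in a ∷ s₀ ∷ s' would give the peak s₀ b c in the stack already.
blocked-push-below-top : ∀ a s₀ s' → containsSome peakPatterns (s₀ ∷ s') ≡ false → Distinct (a ∷ s₀ ∷ s') →
  containsSome peakPatterns (a ∷ s₀ ∷ s') ≡ true → a < s₀
blocked-push-below-top a s₀ s' avoids d blocked with <-cmp a s₀
... | tri< a<s₀ _ _ = a<s₀
... | tri≈ _ refl _ = ⊥-elim (n>0⇒n≢0 (occ-self a s') (distinct-head d))
... | tri> _ _ s₀<a = ⊥-elim (false≢true (trans (sym noPeak) peak))
  where
  false≢true : false ≢ true
  false≢true ()
  noPeak : hasPeak (s₀ ∷ s') ≡ false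
  noPeak = trans (sym (containsSome-peakPatterns (s₀ ∷ s'))) avoids
  s₀-fresh : occ s₀ s' ≡ 0
  s₀-fresh = distinct-head {s₀} {s'} (distinct-sub (λ y → occ-≤-∷ y a (s₀ ∷ s')) d)
  peakFrom-a : any (peakFrom a) (pairs (s₀ ∷ s')) ≡ true
  peakFrom-a with ∨-true _ _ (trans (sym (containsSome-peakPatterns (a ∷ s₀ ∷ s'))) blocked)
  ... | inj₁ x = x
  ... | inj₂ x = ⊥-elim (false≢true (trans (sym noPeak) x))
  peak : hasPeak (s₀ ∷ s') ≡ true
  peak with ∨-true (any (peakFrom a) (map (s₀ ,_) s')) (any (peakFrom a) (pairs s'))
                   (trans (sym (any-++ (peakFrom a) (map (s₀ ,_) s') (pairs s'))) peakFrom-a)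
  ... | inj₁ m with any-witness (λ c → peakFrom a (s₀ , c)) s' (trans (sym (any-map (peakFrom a) (s₀ ,_) s')) m)
  ...   | c , _ , t = ⊥-elim (<-asym s₀<a (proj₁ (peakAt-sound a s₀ c t)))
  peak | inj₂ m = cong (_∨ hasPeak s') (any-pairs-mono (peakFrom a) (peakFrom s₀) s' m shift)
    where shift : ∀ b c → 0 < occ b s' → 0 < occ c s' → peakFrom a (b , c) ≡ true → peakFrom s₀ (b , c) ≡ true
          shift b c ob oc t with peakAt-sound a b c t
          ... | a<b , c<b , _ = peakAt-complete (<-trans s₀<a a<b) c<b
                                  (λ e → n>0⇒n≢0 (subst (λ z → 0 < occ z s') (sym e) oc) s₀-fresh)

pushesFreely : List ℕ → List ℕ → Bool
pushesFreely []       s = true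
pushesFreely (x ∷ xs) s = not (containsSome peakPatterns (x ∷ s)) ∧ pushesFreely xs (x ∷ s)

freePrefix : List ℕ → List ℕ → ℕ
freePrefix []       s = 0
freePrefix (x ∷ xs) s = if containsSome peakPatterns (x ∷ s) then 0 else suc (freePrefix xs (x ∷ s))

runPrefix-free : ∀ α s → pushesFreely α s ≡ true → runPrefix peakPatterns α s ≡ ([] , α ʳ++ s)
runPrefix-free []      s e = refl
runPrefix-free (x ∷ α) s e with ∧-true _ _ e
... | e₁ , e₂ rewrite popUntil-stop peakPatterns x s (not-injective e₁) | runPrefix-free α (x ∷ s) e₂ = refl

occ-ʳ++ : ∀ y α s → occ y (α ʳ++ s) ≡ occ y α + occ y s
occ-ʳ++ y []      s = refl
occ-ʳ++ y (x ∷ α) s = trans (occ-ʳ++ y α (x ∷ s)) (rearrange (occ y α) (if y ≡ᵇ x then 1 else 0) (occ y s))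
  where rearrange : ∀ a b c → a + (b + c) ≡ b + a + c
        rearrange a b c = trans (sym (+-assoc a b c)) (cong (_+ c) (+-comm a b))

stack-avoids : ∀ x α s → ∃₂ λ y r → proj₂ (runPrefix peakPatterns (x ∷ α) s) ≡ y ∷ r × containsSome peakPatterns (y ∷ r) ≡ false
stack-avoids x []       s = x , proj₂ (popUntil peakPatterns x s) , refl , popUntil-avoids peakPatterns x s refl
stack-avoids x (x' ∷ α) s = stack-avoids x' α (x ∷ proj₂ (popUntil peakPatterns x s))

push-max-avoids : ∀ N st → containsSome peakPatterns st ≡ false → Below N st → containsSome peakPatterns (N ∷ st) ≡ false
push-max-avoids N st avoids b = trans (containsSome-peakPatterns (N ∷ st))
  (cong₂ _∨_ (any-pairs-false (peakFrom N) st (λ b' c o → notAbove b' c (below b b' o)))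
             (trans (sym (containsSome-peakPatterns st)) avoids))
  where notAbove : ∀ b' c → b' < N → peakFrom N (b' , c) ≡ false
        notAbove b' c lt rewrite <ᵇ-false (<⇒≤ lt) = refl

push-under-max-blocked : ∀ x N s₀ s' → x < N → s₀ < N → x ≢ s₀ → containsSome peakPatterns (x ∷ N ∷ s₀ ∷ s') ≡ true
push-under-max-blocked x N s₀ s' x<N s₀<N x≢s₀
  rewrite containsSome-peakPatterns (x ∷ N ∷ s₀ ∷ s') | peakAt-complete x<N s₀<N x≢s₀ = refl

tStackRun-max-popped : ∀ N β s₀ s' → Below N β → s₀ < N → (∀ x → 0 < occ x β → x ≢ s₀) →
  tStackRun peakPatterns β (N ∷ s₀ ∷ s') ≡ N ∷ tStackRun peakPatterns β (s₀ ∷ s')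
tStackRun-max-popped N []      s₀ s' bβ s₀<N fresh = refl
tStackRun-max-popped N (x ∷ β) s₀ s' bβ s₀<N fresh = trans (tStackRun-∷ peakPatterns x β (N ∷ s₀ ∷ s'))
  (trans (cong (λ p → proj₁ p ++ tStackRun peakPatterns β (x ∷ proj₂ p))
               (popUntil-pop peakPatterns x N (s₀ ∷ s') (push-under-max-blocked x N s₀ s' (below-head bβ) s₀<N (fresh x (occ-self x β)))))
         (cong (N ∷_) (sym (tStackRun-∷ peakPatterns x β (s₀ ∷ s')))))

classical-pops-below-max : ∀ N s → Below N s → popUntil classical N s ≡ (s , [])
classical-pops-below-max N []      b = refl
classical-pops-below-max N (y ∷ s) b =
  trans (popUntil-pop classical N y s (trans (containsSome-classical (N ∷ y ∷ s)) (inversion (<ᵇ-true (below-head b)))))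
        (cong (λ p → y ∷ proj₁ p , proj₂ p) (classical-pops-below-max N s (below-tail b)))
  where inversion : (y <ᵇ N) ≡ true → hasInversion (N ∷ y ∷ s) ≡ true
        inversion e rewrite e = refl

tStack-classical-max : ∀ N u v → Below N u → Below N v →
  tStack classical (u ++ N ∷ v) ≡ tStack classical u ++ (tStack classical v ++ [ N ])
tStack-classical-max N u v bu bv = begin
  tStackRun classical (u ++ N ∷ v) []
    ≡⟨ tStackRun-++ classical u (N ∷ v) [] ⟩
  o ++ tStackRun classical (N ∷ v) st
    ≡⟨ cong (o ++_) (tStackRun-∷ classical N v st) ⟩
  o ++ (proj₁ (popUntil classical N st) ++ tStackRun classical v (N ∷ proj₂ (popUntil classical N st)))
    ≡⟨ cong (λ p → o ++ (proj₁ p ++ tStackRun classical v (N ∷ proj₂ p))) (classical-pops-below-max N st (below-stack classical u bu)) ⟩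
  o ++ (st ++ tStackRun classical v ([] ++ [ N ]))
    ≡⟨ cong (λ z → o ++ (st ++ z)) (tStackRun-∷ʳ classical N (classical-bottomBlind N) (λ _ → refl) v [] bv (below-[] N)) ⟩
  o ++ (st ++ (tStackRun classical v [] ++ [ N ]))
    ≡⟨ ++-assoc o st _ ⟨
  (o ++ st) ++ (tStackRun classical v [] ++ [ N ])
    ≡⟨ cong (_++ (tStackRun classical v [] ++ [ N ])) (tStackRun-flush classical u []) ⟨
  tStack classical u ++ (tStack classical v ++ [ N ]) ∎
  where open ≡-Reasoning
        o = proj₁ (runPrefix classical u [])
        st = proj₂ (runPrefix classical u [])

blocked-push-pops-larger : ∀ a s → containsSome peakPatterns s ≡ false → Distinct (a ∷ s) →
  containsSome peakPatterns (a ∷ s) ≡ true → ∃ λ y → 0 < occ y (proj₁ (popUntil peakPatterns a s)) × a < y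
blocked-push-pops-larger a []        avoids d ()
blocked-push-pops-larger a (s₀ ∷ s') avoids d blocked rewrite popUntil-pop peakPatterns a s₀ s' blocked =
  s₀ , occ-self s₀ (proj₁ (popUntil peakPatterns a s')) , blocked-push-below-top a s₀ s' avoids d blocked

blocked-prefix-inversion : ∀ α s → containsSome peakPatterns s ≡ false → Distinct (α ++ s) → pushesFreely α s ≡ false →
  ∃₂ λ y x → 0 < occ y (proj₁ (runPrefix peakPatterns α s)) × 0 < occ x (proj₂ (runPrefix peakPatterns α s)) × x < y
blocked-prefix-inversion []      s avoids d ()
blocked-prefix-inversion (a ∷ α) s avoids d e = byPush (containsSome peakPatterns (a ∷ s)) refl
  where
  o = proj₁ (popUntil peakPatterns a s)
  r = proj₂ (popUntil peakPatterns a s)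
  distinct-moved : ∀ {t} → (∀ y → occ y t ≤ occ y s) → Distinct (α ++ a ∷ t)
  distinct-moved le = distinct-sub (λ y → ≤-trans (≤-reflexive (occ-++-∷ y a α _))
                                            (+-monoʳ-≤ (if y ≡ᵇ a then 1 else 0) (occ-++-monoʳ y α (le y)))) d
  distinct-top : Distinct (a ∷ s)
  distinct-top = distinct-sub (λ y → +-monoʳ-≤ (if y ≡ᵇ a then 1 else 0) (occ-≤-++ʳ y α s)) d
  byPush : ∀ c → containsSome peakPatterns (a ∷ s) ≡ c →
    ∃₂ λ y x → 0 < occ y (proj₁ (runPrefix peakPatterns (a ∷ α) s)) × 0 < occ x (proj₂ (runPrefix peakPatterns (a ∷ α) s)) × x < y
  byPush false ec with blocked-prefix-inversion α (a ∷ s) ec (distinct-moved (λ _ → ≤-refl))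
                                                  (subst (λ z → not z ∧ pushesFreely α (a ∷ s) ≡ false) ec e)
  ... | y , x , py , px , x<y rewrite popUntil-stop peakPatterns a s ec = y , x , py , px , x<y
  byPush true ec with blocked-push-pops-larger a s avoids distinct-top ec | pushesFreely α (a ∷ r) in free
  ... | y , py , a<y | true rewrite runPrefix-free α (a ∷ r) free =
    y , a , subst (0 <_) (sym (trans (occ-++ y o []) (+-identityʳ _))) py ,
    subst (0 <_) (sym (occ-ʳ++ a α (a ∷ r))) (≤-trans (occ-self a r) (m≤n+m _ (occ a α))) , a<y
  ... | _ | false with blocked-prefix-inversion α (a ∷ r) (popUntil-avoids peakPatterns a s refl)
                                                (distinct-moved (occ-remaining-≤ peakPatterns a s)) free
  ...   | y , x , py , px , x<y = y , x , subst (0 <_) (sym (occ-++ y o _)) (≤-trans py (m≤n+m _ _)) , px , x<y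

tStack-max-first : ∀ N β → Below N β → tStack peakPatterns (N ∷ β) ≡ tStack peakPatterns β ++ [ N ]
tStack-max-first N β bβ = tStackRun-∷ʳ peakPatterns N (peakPatterns-bottomBlind N) (λ _ → refl) β [] bβ (below-[] N)

-- Whatever the prefix a ∷ α leaves on the stack, the maximum N is pushed on it and popped by the next element.
tStack-max-after : ∀ N a α β → Below N ((a ∷ α) ++ β) → Distinct ((a ∷ α) ++ β) →
  tStack peakPatterns ((a ∷ α) ++ N ∷ β)
    ≡ proj₁ (runPrefix peakPatterns (a ∷ α) []) ++ N ∷ tStackRun peakPatterns β (proj₂ (runPrefix peakPatterns (a ∷ α) []))
tStack-max-after N a α β b d with stack-avoids a α []
... | y , r , st≡ , avoids = begin
  tStackRun peakPatterns ((a ∷ α) ++ N ∷ β) []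
    ≡⟨ tStackRun-++ peakPatterns (a ∷ α) (N ∷ β) [] ⟩
  o ++ tStackRun peakPatterns (N ∷ β) st
    ≡⟨ cong (o ++_) (tStackRun-∷ peakPatterns N β st) ⟩
  o ++ (proj₁ (popUntil peakPatterns N st) ++ tStackRun peakPatterns β (N ∷ proj₂ (popUntil peakPatterns N st)))
    ≡⟨ cong (λ p → o ++ (proj₁ p ++ tStackRun peakPatterns β (N ∷ proj₂ p)))
            (popUntil-stop peakPatterns N st (push-max-avoids N st (subst (λ z → containsSome peakPatterns z ≡ false) (sym st≡) avoids) b-st)) ⟩
  o ++ tStackRun peakPatterns β (N ∷ st)
    ≡⟨ cong (λ z → o ++ tStackRun peakPatterns β (N ∷ z)) st≡ ⟩
  o ++ tStackRun peakPatterns β (N ∷ y ∷ r)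
    ≡⟨ cong (o ++_) (tStackRun-max-popped N β y r (below-++ʳ (a ∷ α) β b) (below (subst (Below N) st≡ b-st) y (occ-self y r)) y-fresh) ⟩
  o ++ N ∷ tStackRun peakPatterns β (y ∷ r)
    ≡⟨ cong (λ z → o ++ N ∷ tStackRun peakPatterns β z) st≡ ⟨
  o ++ N ∷ tStackRun peakPatterns β st ∎
  where
  open ≡-Reasoning
  o = proj₁ (runPrefix peakPatterns (a ∷ α) [])
  st = proj₂ (runPrefix peakPatterns (a ∷ α) [])
  b-st : Below N st
  b-st = below-stack peakPatterns (a ∷ α) (below-++ˡ (a ∷ α) β b)
  y∈α : 0 < occ y (a ∷ α)
  y∈α = ≤-trans (subst (λ z → 0 < occ y z) (sym st≡) (occ-self y r)) (occ-stack-≤ peakPatterns (a ∷ α) y)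
  y-fresh : ∀ x → 0 < occ x β → x ≢ y
  y-fresh x px e = distinct-disjoint (a ∷ α) β y x d y∈α px (sym e)

-- Inserting the maximum

tMachine-insertMax-free : ∀ N α β → Below N (α ++ β) → Distinct (α ++ β) → pushesFreely α [] ≡ true →
  tMachine peakPatterns (α ++ N ∷ β) ≡ tMachine peakPatterns (α ++ β) ++ [ N ]
tMachine-insertMax-free N [] β b d e =
  trans (cong (tStack classical) (tStack-max-first N β b))
        (tStack-classical-max N (tStack peakPatterns β) [] (below-tStackRun peakPatterns β [] b (below-[] N)) (below-[] N))
tMachine-insertMax-free N (a ∷ α) β b d e = begin
  tStack classical (tStack peakPatterns ((a ∷ α) ++ N ∷ β))
    ≡⟨ cong (tStack classical) (tStack-max-after N a α β b d) ⟩
  tStack classical (proj₁ (runPrefix peakPatterns (a ∷ α) []) ++ N ∷ rest)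
    ≡⟨ cong (λ p → tStack classical (proj₁ p ++ N ∷ tStackRun peakPatterns β (proj₂ p))) free ⟩
  tStack classical ([] ++ N ∷ rest')
    ≡⟨ tStack-classical-max N [] rest' (below-[] N) b-rest ⟩
  tStack classical rest' ++ [ N ]
    ≡⟨ cong (λ p → tStack classical (proj₁ p ++ tStackRun peakPatterns β (proj₂ p)) ++ [ N ]) free ⟨
  tStack classical (proj₁ (runPrefix peakPatterns (a ∷ α) []) ++ rest) ++ [ N ]
    ≡⟨ cong (λ z → tStack classical z ++ [ N ]) (tStackRun-++ peakPatterns (a ∷ α) β []) ⟨
  tStack classical (tStack peakPatterns ((a ∷ α) ++ β)) ++ [ N ] ∎
  where
  open ≡-Reasoning
  rest = tStackRun peakPatterns β (proj₂ (runPrefix peakPatterns (a ∷ α) []))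
  rest' = tStackRun peakPatterns β ((a ∷ α) ʳ++ [])
  free = runPrefix-free (a ∷ α) [] e
  b-rest : Below N rest'
  b-rest = below-tStackRun peakPatterns β _ (below-++ʳ (a ∷ α) β b)
             (subst (Below N) (cong proj₂ free) (below-stack peakPatterns (a ∷ α) (below-++ˡ (a ∷ α) β b)))

tMachine-insertMax-blocked : ∀ N α β → Below N (α ++ β) → Distinct (α ++ β) → pushesFreely α [] ≡ false →
  ∃₂ λ y x → x < y × ∃₂ λ A B → tMachine peakPatterns (α ++ N ∷ β) ≡ A ++ B × 0 < occ y A × 0 < occ x B
tMachine-insertMax-blocked N []      β b d ()
tMachine-insertMax-blocked N (a ∷ α) β b d e
  with blocked-prefix-inversion (a ∷ α) [] refl (distinct-sub (λ y → subst (_≤ occ y ((a ∷ α) ++ β)) (cong (occ y) (sym (++-identityʳ (a ∷ α)))) (occ-≤-++ˡ y (a ∷ α) β)) d) e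
... | y , x , py , px , x<y = y , x , x<y , tStack classical o , tStack classical rest ++ [ N ] ,
  trans (cong (tStack classical) (tStack-max-after N a α β b d))
        (tStack-classical-max N o rest (below-sub (occ-output-≤ peakPatterns (a ∷ α)) (below-++ˡ (a ∷ α) β b))
          (below-tStackRun peakPatterns β st (below-++ʳ (a ∷ α) β b) (below-stack peakPatterns (a ∷ α) (below-++ˡ (a ∷ α) β b)))) ,
  subst (0 <_) (sym (trans (occ-tStackRun classical o [] y) (+-identityʳ _))) py ,
  ≤-trans (subst (0 <_) (sym (trans (occ-tStackRun classical rest [] x) (trans (+-identityʳ _) (occ-tStackRun peakPatterns β st x))))
                          (≤-trans px (m≤n+m _ _)))
          (occ-≤-++ˡ x (tStack classical rest) [ N ])
  where o = proj₁ (runPrefix peakPatterns (a ∷ α) [])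
        st = proj₂ (runPrefix peakPatterns (a ∷ α) [])
        rest = tStackRun peakPatterns β st

Increasing : List ℕ → Set
Increasing []      = ⊤
Increasing (x ∷ l) = (∀ y → 0 < occ y l → x < y) × Increasing l

occ-∷-case : ∀ y a l → 0 < occ y (a ∷ l) → y ≡ a ⊎ 0 < occ y l
occ-∷-case y a l p with y ≡ᵇ a in e
... | true  = inj₁ (≡ᵇ-sound y a e)
... | false = inj₂ p

increasing-++ : ∀ A B y x → Increasing (A ++ B) → 0 < occ y A → 0 < occ x B → y < x
increasing-++ (a ∷ A) B y x (a<l , inc) py px with occ-∷-case y a A py
... | inj₁ refl = a<l x (≤-trans px (occ-≤-++ʳ x A B))
... | inj₂ q    = increasing-++ A B y x inc q px

occ-applyUpTo : ∀ n (g : ℕ → ℕ) y → 0 < occ y (applyUpTo g n) → ∃ λ i → y ≡ g i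
occ-applyUpTo (suc n) g y p with occ-∷-case y (g 0) (applyUpTo (g ∘ suc) n) p
... | inj₁ e = 0 , e
... | inj₂ q with occ-applyUpTo n (g ∘ suc) y q
...   | i , e = suc i , e

increasing-applyUpTo : ∀ n (g : ℕ → ℕ) → (∀ {i j} → i < j → g i < g j) → Increasing (applyUpTo g n)
increasing-applyUpTo zero    g mono = tt
increasing-applyUpTo (suc n) g mono = head , increasing-applyUpTo n (g ∘ suc) (mono ∘ s<s)
  where head : ∀ y → 0 < occ y (applyUpTo (g ∘ suc) n) → g 0 < y
        head y p with occ-applyUpTo n (g ∘ suc) y p
        ... | i , refl = mono z<s

increasing-idPerm : ∀ n → Increasing (idPerm n)
increasing-idPerm n = subst Increasing (sym (map-applyUpTo id suc n)) (increasing-applyUpTo n suc s<s)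

idPerm-suc : ∀ n → idPerm (suc n) ≡ idPerm n ++ [ suc n ]
idPerm-suc n = trans (cong (map suc) (sym (applyUpTo-∷ʳ id n))) (map-++ suc (upTo n) [ n ])

isYes-cong : ∀ {P Q : Set} (p : Dec P) (q : Dec Q) → (P → Q) → (Q → P) → isYes p ≡ isYes q
isYes-cong (yes p) (yes q) f g = refl
isYes-cong (yes p) (no ¬q) f g = ⊥-elim (¬q (f p))
isYes-cong (no ¬p) (yes q) f g = ⊥-elim (¬p (g q))
isYes-cong (no ¬p) (no ¬q) f g = refl

isYes-false : ∀ {P : Set} (p : Dec P) → ¬ P → isYes p ≡ false
isYes-false (yes p) ¬p = ⊥-elim (¬p p)
isYes-false (no _)  ¬p = refl

isSortable-∷ʳ : ∀ π σ n → tMachine peakPatterns π ≡ tMachine peakPatterns σ ++ [ suc n ] →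
  length π ≡ suc n → length σ ≡ n → isSortable peakPatterns π ≡ isSortable peakPatterns σ
isSortable-∷ʳ π σ n e lπ lσ rewrite lπ | lσ | e | idPerm-suc n =
  isYes-cong (≡-dec _≟_ (tMachine peakPatterns σ ++ [ suc n ]) (idPerm n ++ [ suc n ])) (≡-dec _≟_ (tMachine peakPatterns σ) (idPerm n))
             (∷ʳ-injectiveˡ (tMachine peakPatterns σ) (idPerm n)) (cong (_++ [ suc n ]))

isSortable-inversion : ∀ π y x A B → x < y → tMachine peakPatterns π ≡ A ++ B → 0 < occ y A → 0 < occ x B →
  isSortable peakPatterns π ≡ false
isSortable-inversion π y x A B x<y e py px = isYes-false (≡-dec _≟_ (tMachine peakPatterns π) (idPerm (length π)))
  (λ sorted → <-asym x<y (increasing-++ A B y x (subst Increasing (trans (sym sorted) e) (increasing-idPerm (length π))) py px))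

insertAt : ℕ → ℕ → List ℕ → List ℕ
insertAt N k σ = take k σ ++ N ∷ drop k σ

isSortable-insertAt : ∀ n k σ → Below (suc n) σ → Distinct σ → length σ ≡ n →
  isSortable peakPatterns (insertAt (suc n) k σ) ≡ isSortable peakPatterns σ ∧ pushesFreely (take k σ) []
isSortable-insertAt n k σ b d lσ = byFreedom (pushesFreely α []) refl
  where
  α = take k σ
  β = drop k σ
  split = take++drop≡id k σ
  b' : Below (suc n) (α ++ β)
  b' = subst (Below (suc n)) (sym split) b
  d' : Distinct (α ++ β)
  d' = subst Distinct (sym split) d
  byFreedom : ∀ c → pushesFreely α [] ≡ c → isSortable peakPatterns (α ++ suc n ∷ β) ≡ isSortable peakPatterns σ ∧ c
  byFreedom true e = trans (isSortable-∷ʳ (α ++ suc n ∷ β) σ n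
      (subst (λ z → tMachine peakPatterns (α ++ suc n ∷ β) ≡ tMachine peakPatterns z ++ [ suc n ]) split (tMachine-insertMax-free (suc n) α β b' d' e))
      (trans (length-++-sucʳ α (suc n) β) (cong suc (trans (cong length split) lσ))) lσ)
    (sym (∧-identityʳ _))
  byFreedom false e with tMachine-insertMax-blocked (suc n) α β b' d' e
  ... | y , x , x<y , A , B , eq , py , px = trans (isSortable-inversion (α ++ suc n ∷ β) y x A B x<y eq py px) (sym (∧-zeroʳ _))

pushesFreely-take : ∀ k σ s → k ≤ length σ → pushesFreely (take k σ) s ≡ (k <ᵇ suc (freePrefix σ s))
pushesFreely-take zero    σ       s _ = refl
pushesFreely-take (suc k) (x ∷ σ) s (s≤s k≤) with containsSome peakPatterns (x ∷ s)
... | true  = refl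
... | false = pushesFreely-take k σ (x ∷ s) k≤

freePrefix-≤ : ∀ σ s → freePrefix σ s ≤ length σ
freePrefix-≤ []      s = z≤n
freePrefix-≤ (x ∷ σ) s with containsSome peakPatterns (x ∷ s)
... | true  = z≤n
... | false = s≤s (freePrefix-≤ σ (x ∷ s))

freePrefix-∷ʳ : ∀ N xs t → Below N xs → Below N t → freePrefix xs (t ++ [ N ]) ≡ freePrefix xs t
freePrefix-∷ʳ N []       t bx bt = refl
freePrefix-∷ʳ N (x ∷ xs) t bx bt rewrite peakPatterns-bottomBlind N x t (below-∷ (below-head bx) bt)
  with containsSome peakPatterns (x ∷ t)
... | true  = refl
... | false = cong suc (freePrefix-∷ʳ N xs (x ∷ t) (below-tail bx) (below-∷ (below-head bx) bt))

freePrefix-++ : ∀ α w s → pushesFreely α s ≡ true → freePrefix (α ++ w) s ≡ length α + freePrefix w (α ʳ++ s)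
freePrefix-++ []      w s e = refl
freePrefix-++ (x ∷ α) w s e with containsSome peakPatterns (x ∷ s)
freePrefix-++ (x ∷ α) w s () | true
... | false = cong suc (freePrefix-++ α w (x ∷ s) e)

freePrefix-max-popped : ∀ N β y r → Below N β → y < N → (∀ x → 0 < occ x β → x ≢ y) → freePrefix β (N ∷ y ∷ r) ≡ 0
freePrefix-max-popped N []      y r b y<N fresh = refl
freePrefix-max-popped N (x ∷ β) y r b y<N fresh
  rewrite push-under-max-blocked x N y r (below-head b) y<N (fresh x (occ-self x β)) = refl

freePrefix-insertAfter : ∀ N a α' β → Below N ((a ∷ α') ++ β) → Distinct ((a ∷ α') ++ β) →
  pushesFreely (a ∷ α') [] ≡ true → freePrefix ((a ∷ α') ++ N ∷ β) [] ≡ suc (suc (length α'))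
freePrefix-insertAfter N a α' β b d free with stack-avoids a α' []
... | y , r , st≡ , avoids = begin
  freePrefix ((a ∷ α') ++ N ∷ β) []
    ≡⟨ freePrefix-++ (a ∷ α') (N ∷ β) [] free ⟩
  suc (length α') + freePrefix (N ∷ β) ((a ∷ α') ʳ++ [])
    ≡⟨ cong (λ z → suc (length α') + freePrefix (N ∷ β) z) stack≡ ⟩
  suc (length α') + freePrefix (N ∷ β) (y ∷ r)
    ≡⟨ cong (λ z → suc (length α') + (if z then 0 else suc (freePrefix β (N ∷ y ∷ r)))) (push-max-avoids N (y ∷ r) avoids b-st) ⟩
  suc (length α') + suc (freePrefix β (N ∷ y ∷ r))
    ≡⟨ cong (λ z → suc (length α') + suc z) (freePrefix-max-popped N β y r (below-++ʳ (a ∷ α') β b) (below b-st y (occ-self y r)) y-fresh) ⟩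
  suc (length α') + 1
    ≡⟨ +-comm (suc (length α')) 1 ⟩
  suc (suc (length α')) ∎
  where
  open ≡-Reasoning
  stack≡ : (a ∷ α') ʳ++ [] ≡ y ∷ r
  stack≡ = trans (sym (cong proj₂ (runPrefix-free (a ∷ α') [] free))) st≡
  inPrefix : ∀ z → 0 < occ z (y ∷ r) → 0 < occ z (a ∷ α')
  inPrefix z p = subst (0 <_) (trans (occ-ʳ++ z (a ∷ α') []) (+-identityʳ _)) (subst (λ w → 0 < occ z w) (sym stack≡) p)
  b-st : Below N (y ∷ r)
  b-st = mkBelow λ z p → below (below-++ˡ (a ∷ α') β b) z (inPrefix z p)
  y-fresh : ∀ x → 0 < occ x β → x ≢ y
  y-fresh x px e = distinct-disjoint (a ∷ α') β y x d (inPrefix y (occ-self y r)) px (sym e)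

freePrefix-insertAt : ∀ N k σ → Below N σ → Distinct σ → k ≤ freePrefix σ [] →
  freePrefix (insertAt N k σ) [] ≡ childLabel k (freePrefix σ [])
freePrefix-insertAt N zero    σ b d k≤ = cong suc (freePrefix-∷ʳ N σ [] b (below-[] N))
freePrefix-insertAt N (suc k) σ b d k≤ = byPrefix (take (suc k) σ) refl
  where
  k<σ : suc k ≤ length σ
  k<σ = ≤-trans k≤ (freePrefix-≤ σ [])
  free : pushesFreely (take (suc k) σ) [] ≡ true
  free = trans (pushesFreely-take (suc k) σ [] k<σ) (<ᵇ-true (s≤s k≤))
  length-prefix : length (take (suc k) σ) ≡ suc k
  length-prefix = trans (length-take (suc k) σ) (m≤n⇒m⊓n≡m k<σ)
  byPrefix : ∀ t → take (suc k) σ ≡ t → freePrefix (take (suc k) σ ++ N ∷ drop (suc k) σ) [] ≡ suc (suc k)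
  byPrefix []       e = ⊥-elim (1+n≢0 (trans (sym length-prefix) (cong length e)))
  byPrefix (a ∷ α') e = begin
    freePrefix (take (suc k) σ ++ N ∷ drop (suc k) σ) []
      ≡⟨ cong (λ z → freePrefix (z ++ N ∷ drop (suc k) σ) []) e ⟩
    freePrefix ((a ∷ α') ++ N ∷ drop (suc k) σ) []
      ≡⟨ freePrefix-insertAfter N a α' (drop (suc k) σ) (subst (Below N) split b) (subst Distinct split d)
                                (subst (λ z → pushesFreely z [] ≡ true) e free) ⟩
    suc (suc (length α'))
      ≡⟨ cong suc (trans (sym (cong length e)) length-prefix) ⟩
    suc (suc k) ∎
    where open ≡-Reasoning
          split : σ ≡ (a ∷ α') ++ drop (suc k) σ
          split = trans (sym (take++drop≡id (suc k) σ)) (cong (_++ drop (suc k) σ) e)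

-- Permutations

IsPermutation : ℕ → List ℕ → Set
IsPermutation n π = length π ≡ n × (∀ i → i < n → occ (suc i) π ≡ 1)

all-applyUpTo⁻ : ∀ (p : ℕ → Bool) g n → all p (applyUpTo g n) ≡ true → ∀ i → i < n → p (g i) ≡ true
all-applyUpTo⁻ p g (suc n) e zero    _         = proj₁ (∧-true _ _ e)
all-applyUpTo⁻ p g (suc n) e (suc i) (s≤s i<n) = all-applyUpTo⁻ p (g ∘ suc) n (proj₂ (∧-true _ _ e)) i i<n

all-applyUpTo⁺ : ∀ (p : ℕ → Bool) g n → (∀ i → i < n → p (g i) ≡ true) → all p (applyUpTo g n) ≡ true
all-applyUpTo⁺ p g zero    h = refl
all-applyUpTo⁺ p g (suc n) h rewrite h 0 z<s = all-applyUpTo⁺ p (g ∘ suc) n (λ i i<n → h (suc i) (s<s i<n))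

isPerm-sound : ∀ n π → isPerm n π ≡ true → IsPermutation n π
isPerm-sound n π e with ∧-true _ _ e
... | e₁ , e₂ = ≡ᵇ-sound _ _ e₁ , λ i i<n → ≡ᵇ-sound _ _
  (all-applyUpTo⁻ (λ i → occ i π ≡ᵇ 1) suc n (subst (λ z → all (λ i → occ i π ≡ᵇ 1) z ≡ true) (map-applyUpTo id suc n) e₂) i i<n)

isPerm-complete : ∀ n π → IsPermutation n π → isPerm n π ≡ true
isPerm-complete n π (l , h) rewrite l | ≡ᵇ-refl n =
  subst (λ z → all (λ i → occ i π ≡ᵇ 1) z ≡ true) (sym (map-applyUpTo id suc n))
        (all-applyUpTo⁺ _ suc n (λ i i<n → subst (λ z → (z ≡ᵇ 1) ≡ true) (sym (h i i<n)) refl))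

≡ᵇ-suc-< : ∀ {i n} → i < n → (suc i ≡ᵇ suc n) ≡ false
≡ᵇ-suc-< i<n = ≡ᵇ-false (λ e → <-irrefl (suc-injective e) i<n)

occ-max-absent : ∀ N σ → Below N σ → occ N σ ≡ 0
occ-max-absent N σ b with occ N σ in e
... | zero  = refl
... | suc k = ⊥-elim (<-irrefl refl (below b N (subst (0 <_) (sym e) z<s)))

isPermutation-insertAt : ∀ n k σ → IsPermutation n σ → occ (suc n) σ ≡ 0 → IsPermutation (suc n) (insertAt (suc n) k σ)
isPermutation-insertAt n k σ (l , h) absent =
  trans (length-++-sucʳ (take k σ) (suc n) (drop k σ)) (cong suc (trans (cong length (take++drop≡id k σ)) l)) , once
  where
  once : ∀ i → i < suc n → occ (suc i) (insertAt (suc n) k σ) ≡ 1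
  once i i<n = trans (occ-++-∷ (suc i) (suc n) (take k σ) (drop k σ))
    (trans (cong ((if suc i ≡ᵇ suc n then 1 else 0) +_) (cong (occ (suc i)) (take++drop≡id k σ)))
           (byCase (m≤n⇒m<n∨m≡n (≤-pred i<n))))
    where
    byCase : i < n ⊎ i ≡ n → (if suc i ≡ᵇ suc n then 1 else 0) + occ (suc i) σ ≡ 1
    byCase (inj₁ i<n') rewrite ≡ᵇ-suc-< i<n' = h i i<n'
    byCase (inj₂ refl) rewrite ≡ᵇ-refl i | absent = refl

splitAround : ℕ → List ℕ → List ℕ × List ℕ
splitAround N []       = [] , []
splitAround N (x ∷ xs) = if N ≡ᵇ x then ([] , xs) else (x ∷ proj₁ (splitAround N xs) , proj₂ (splitAround N xs))

splitAround-correct : ∀ N π → 0 < occ N π → π ≡ proj₁ (splitAround N π) ++ N ∷ proj₂ (splitAround N π)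
splitAround-correct N (x ∷ π) p with N ≡ᵇ x in e
... | true  = cong (_∷ π) (sym (≡ᵇ-sound N x e))
... | false = cong (x ∷_) (splitAround-correct N π p)

splitAround-++-∷ : ∀ N α β → occ N α ≡ 0 → splitAround N (α ++ N ∷ β) ≡ (α , β)
splitAround-++-∷ N []      β absent rewrite ≡ᵇ-refl N = refl
splitAround-++-∷ N (x ∷ α) β absent with N ≡ᵇ x
... | true  = ⊥-elim (1+n≢0 absent)
... | false rewrite splitAround-++-∷ N α β absent = refl

isPermutation-removeMax : ∀ n π → IsPermutation (suc n) π →
  let (α , β) = splitAround (suc n) π in π ≡ α ++ suc n ∷ β × IsPermutation n (α ++ β)
isPermutation-removeMax n π (l , h) = π≡ , suc-injective (trans (sym (length-++-sucʳ α (suc n) β)) (trans (cong length (sym π≡)) l)) , once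
  where
  α = proj₁ (splitAround (suc n) π)
  β = proj₂ (splitAround (suc n) π)
  π≡ : π ≡ α ++ suc n ∷ β
  π≡ = splitAround-correct (suc n) π (subst (0 <_) (sym (h n ≤-refl)) z<s)
  once : ∀ i → i < n → occ (suc i) (α ++ β) ≡ 1
  once i i<n = begin
    occ (suc i) (α ++ β)                                          ≡⟨ cong (λ b → (if b then 1 else 0) + occ (suc i) (α ++ β)) (≡ᵇ-suc-< i<n) ⟨
    (if suc i ≡ᵇ suc n then 1 else 0) + occ (suc i) (α ++ β)      ≡⟨ occ-++-∷ (suc i) (suc n) α β ⟨
    occ (suc i) (α ++ suc n ∷ β)                                  ≡⟨ cong (occ (suc i)) π≡ ⟨
    occ (suc i) π                                                 ≡⟨ h i (m<n⇒m<1+n i<n) ⟩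
    1                                                             ∎
    where open ≡-Reasoning

isPermutation-below-distinct : ∀ n σ → IsPermutation n σ → Below (suc n) σ × Distinct σ
isPermutation-below-distinct zero    []  _  = below-[] 1 , mkDistinct λ y → z≤n
isPermutation-below-distinct (suc n) π pπ with isPermutation-removeMax n π pπ
... | π≡ , pσ with isPermutation-below-distinct n _ pσ
...   | b , d = subst (λ z → Below (suc (suc n)) z × Distinct z) (sym π≡) (b' , d')
  where
  α = proj₁ (splitAround (suc n) π)
  β = proj₂ (splitAround (suc n) π)
  b' : Below (suc (suc n)) (α ++ suc n ∷ β)
  b' = below-sub (λ y → ≤-reflexive (occ-++-∷ y (suc n) α β)) (below-∷ {l = α ++ β} ≤-refl (mkBelow λ y p → m<n⇒m<1+n (below b y p)))
  d' : Distinct (α ++ suc n ∷ β)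
  d' = mkDistinct λ y → subst (_≤ 1) (sym (occ-++-∷ y (suc n) α β)) (byCase y)
    where byCase : ∀ y → (if y ≡ᵇ suc n then 1 else 0) + occ y (α ++ β) ≤ 1
          byCase y with y ≡ᵇ suc n in e
          ... | true  = subst (λ w → 1 + occ w (α ++ β) ≤ 1) (sym (≡ᵇ-sound _ _ e))
                              (≤-reflexive (cong suc (occ-max-absent (suc n) (α ++ β) b)))
          ... | false = distinct d y

-- Counting

Fin-cong : ∀ {m m'} → m ≡ m' → Fin m ↔ Fin m'
Fin-cong refl = ↔-refl

Σ-Fin-suc : ∀ m (B : Fin (suc m) → Set) → Σ (Fin (suc m)) B ↔ (B fzero ⊎ Σ (Fin m) (B ∘ fsuc))
Σ-Fin-suc m B = mk↔ₛ′ to from to∘from from∘to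
  where
  to : Σ (Fin (suc m)) B → B fzero ⊎ Σ (Fin m) (B ∘ fsuc)
  to (fzero  , b) = inj₁ b
  to (fsuc k , b) = inj₂ (k , b)
  from : B fzero ⊎ Σ (Fin m) (B ∘ fsuc) → Σ (Fin (suc m)) B
  from (inj₁ b)       = fzero , b
  from (inj₂ (k , b)) = fsuc k , b
  to∘from : ∀ y → to (from y) ≡ y
  to∘from (inj₁ b)       = refl
  to∘from (inj₂ (k , b)) = refl
  from∘to : ∀ x → from (to x) ≡ x
  from∘to (fzero  , b) = refl
  from∘to (fsuc k , b) = refl

Σ-Fin-sumBelow : ∀ m (f : ℕ → ℕ) → Σ (Fin m) (λ k → Fin (f (toℕ k))) ↔ Fin (sumBelow m f)
Σ-Fin-sumBelow zero    f = mk↔ₛ′ (λ { (() , _) }) (λ ()) (λ ()) (λ { (() , _) })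
Σ-Fin-sumBelow (suc m) f = ↔-trans (Σ-Fin-suc m (λ k → Fin (f (toℕ k))))
  (↔-trans (↔-refl ⊎-↔ Σ-Fin-sumBelow m (f ∘ suc))
  (↔-trans (↔-sym (+↔⊎ {f 0} {sumBelow m (f ∘ suc)})) (Fin-cong (sym (sumBelow-suc m f)))))

Σ-⊤ : ∀ {A : Set} → Σ ⊤ (λ _ → A) ↔ A
Σ-⊤ = mk↔ₛ′ proj₂ (tt ,_) (λ _ → refl) (λ _ → refl)

Σ-Fin1 : ∀ {A : Set} → Σ A (λ _ → Fin 1) ↔ A
Σ-Fin1 = mk↔ₛ′ proj₁ (_, fzero) (λ _ → refl) (λ { (a , fzero) → refl ; (_ , fsuc ()) })

sortablePerm : ℕ → List ℕ → Bool
sortablePerm n π = isPerm n π ∧ isSortable peakPatterns π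

Sortable : ℕ → Set
Sortable n = Σ (List ℕ) (T ∘ sortablePerm n)

Sortable-≡ : ∀ {n π π'} {p : T (sortablePerm n π)} {p' : T (sortablePerm n π')} → π ≡ π' → _≡_ {A = Sortable n} (π , p) (π' , p')
Sortable-≡ {π = π} refl = cong (π ,_) (T-irrelevant _ _)

T-∧⁻ : ∀ a b → T (a ∧ b) → a ≡ true × b ≡ true
T-∧⁻ true true tt = refl , refl

T-∧⁺ : ∀ {a b} → a ≡ true → b ≡ true → T (a ∧ b)
T-∧⁺ refl refl = tt

-- The label of σ in the generating tree: the length of the longest prefix of σ
-- that the {132,231}-stack pushes without popping.
label : List ℕ → ℕ
label σ = freePrefix σ []

take-length-++ : ∀ (α β : List ℕ) → take (length α) (α ++ β) ≡ α
take-length-++ []      β = refl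
take-length-++ (x ∷ α) β = cong (x ∷_) (take-length-++ α β)

drop-length-++ : ∀ (α β : List ℕ) → drop (length α) (α ++ β) ≡ β
drop-length-++ []      β = refl
drop-length-++ (x ∷ α) β = drop-length-++ α β

insertAt-length : ∀ N (α β : List ℕ) → insertAt N (length α) (α ++ β) ≡ α ++ N ∷ β
insertAt-length N α β = cong₂ (λ u v → u ++ N ∷ v) (take-length-++ α β) (drop-length-++ α β)

Σ-Fin-≡ : ∀ {A : Set} (w : A → ℕ) {a a' : A} (e : a ≡ a') {j : Fin (w a)} {j' : Fin (w a')} →
  toℕ j ≡ toℕ j' → _≡_ {A = Σ A (Fin ∘ w)} (a , j) (a' , j')
Σ-Fin-≡ w refl q = cong (_ ,_) (toℕ-injective q)

record SortableFacts (n : ℕ) (σ : List ℕ) : Set where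
  field
    permutation : IsPermutation n σ
    sorted      : isSortable peakPatterns σ ≡ true
    bounded     : Below (suc n) σ
    distinctσ   : Distinct σ

sortableFacts : ∀ n σ → T (sortablePerm n σ) → SortableFacts n σ
sortableFacts n σ p = record
  { permutation = permutation
  ; sorted      = proj₂ (T-∧⁻ _ _ p)
  ; bounded     = proj₁ (isPermutation-below-distinct n σ permutation)
  ; distinctσ   = proj₂ (isPermutation-below-distinct n σ permutation)
  }
  where permutation = isPerm-sound n σ (proj₁ (T-∧⁻ _ _ p))

module MaxInsertion (n : ℕ) where

  children : Sortable n → ℕ
  children s = suc (label (proj₁ s))

  insert : Σ (Sortable n) (Fin ∘ children) → Sortable (suc n)
  insert ((σ , p) , k) = insertAt (suc n) (toℕ k) σ , T-∧⁺
    (isPerm-complete (suc n) (insertAt (suc n) (toℕ k) σ) (isPermutation-insertAt n (toℕ k) σ permutation (occ-max-absent (suc n) σ bounded)))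
    (trans (isSortable-insertAt n (toℕ k) σ bounded distinctσ (proj₁ permutation)) (cong₂ _∧_ sorted free))
    where
    open SortableFacts (sortableFacts n σ p)
    k≤ : toℕ k ≤ label σ
    k≤ = ≤-pred (toℕ<n k)
    free : pushesFreely (take (toℕ k) σ) [] ≡ true
    free = trans (pushesFreely-take (toℕ k) σ [] (≤-trans k≤ (freePrefix-≤ σ []))) (<ᵇ-true (s≤s k≤))

  before after rest : List ℕ → List ℕ
  before π = proj₁ (splitAround (suc n) π)
  after  π = proj₂ (splitAround (suc n) π)
  rest   π = before π ++ after π

  removable : ∀ π → T (sortablePerm (suc n) π) → T (sortablePerm n (rest π)) × length (before π) < suc (label (rest π))
  removable π p = T-∧⁺ (isPerm-complete n (rest π) pσ) (proj₁ both) ,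
                  <ᵇ-sound _ _ (trans (sym (pushesFreely-take k σ [] (length-++-≤ˡ (before π)))) (proj₂ both))
    where
    π≡ = proj₁ (isPermutation-removeMax n π (isPerm-sound (suc n) π (proj₁ (T-∧⁻ _ _ p))))
    pσ = proj₂ (isPermutation-removeMax n π (isPerm-sound (suc n) π (proj₁ (T-∧⁻ _ _ p))))
    σ = rest π
    k = length (before π)
    bd = isPermutation-below-distinct n σ pσ
    both : isSortable peakPatterns σ ≡ true × pushesFreely (take k σ) [] ≡ true
    both = ∧-true _ _ (begin
      isSortable peakPatterns σ ∧ pushesFreely (take k σ) []  ≡⟨ isSortable-insertAt n k σ (proj₁ bd) (proj₂ bd) (proj₁ pσ) ⟨
      isSortable peakPatterns (insertAt (suc n) k σ)          ≡⟨ cong (isSortable peakPatterns) (trans (insertAt-length (suc n) (before π) (after π)) (sym π≡)) ⟩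
      isSortable peakPatterns π                               ≡⟨ proj₂ (T-∧⁻ _ _ p) ⟩
      true                                                    ∎)
      where open ≡-Reasoning

  remove : Sortable (suc n) → Σ (Sortable n) (Fin ∘ children)
  remove (π , p) = (rest π , proj₁ (removable π p)) , fromℕ< (proj₂ (removable π p))

  remove∘insert : ∀ y → remove (insert y) ≡ y
  remove∘insert ((σ , p) , k) = Σ-Fin-≡ children (Sortable-≡ rest≡) (trans (toℕ-fromℕ< _) length≡)
    where
    open SortableFacts (sortableFacts n σ p)
    k' = toℕ k
    k≤σ : k' ≤ length σ
    k≤σ = ≤-trans (≤-pred (toℕ<n k)) (freePrefix-≤ σ [])
    split≡ : splitAround (suc n) (insertAt (suc n) k' σ) ≡ (take k' σ , drop k' σ)
    split≡ = splitAround-++-∷ (suc n) (take k' σ) (drop k' σ)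
      (n≤0⇒n≡0 (subst (occ (suc n) (take k' σ) ≤_) (occ-max-absent (suc n) σ bounded)
                      (subst (occ (suc n) (take k' σ) ≤_) (cong (occ (suc n)) (take++drop≡id k' σ)) (occ-≤-++ˡ (suc n) (take k' σ) (drop k' σ)))))
    rest≡ : rest (insertAt (suc n) k' σ) ≡ σ
    rest≡ = trans (cong₂ _++_ (cong proj₁ split≡) (cong proj₂ split≡)) (take++drop≡id k' σ)
    length≡ : length (before (insertAt (suc n) k' σ)) ≡ k'
    length≡ = trans (cong (length ∘ proj₁) split≡) (trans (length-take k' σ) (m≤n⇒m⊓n≡m k≤σ))

  insert∘remove : ∀ x → insert (remove x) ≡ x
  insert∘remove (π , p) = Sortable-≡ (begin
    insertAt (suc n) (toℕ (fromℕ< (proj₂ (removable π p)))) (rest π) ≡⟨ cong (λ k → insertAt (suc n) k (rest π)) (toℕ-fromℕ< _) ⟩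
    insertAt (suc n) (length (before π)) (rest π)                   ≡⟨ insertAt-length (suc n) (before π) (after π) ⟩
    before π ++ suc n ∷ after π                                     ≡⟨ proj₁ (isPermutation-removeMax n π (isPerm-sound (suc n) π (proj₁ (T-∧⁻ _ _ p)))) ⟨
    π                                                               ∎)
    where open ≡-Reasoning

  insertion : Sortable (suc n) ↔ Σ (Sortable n) (Fin ∘ children)
  insertion = mk↔ₛ′ remove insert remove∘insert insert∘remove

  label-insert : ∀ y → label (proj₁ (insert y)) ≡ childLabel (toℕ (proj₂ y)) (label (proj₁ (proj₁ y)))
  label-insert ((σ , p) , k) = freePrefix-insertAt (suc n) (toℕ k) σ bounded distinctσ (≤-pred (toℕ<n k))
    where open SortableFacts (sortableFacts n σ p)

sumAtDepth : ℕ → (ℕ → ℕ) → ℕ → ℕ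
sumAtDepth zero    g = g
sumAtDepth (suc n) g = sumAtDepth n (sumOverChildren g)

sumAtDepth-sumOverChildren : ∀ n g x → sumAtDepth n (sumOverChildren g) x ≡ sumOverChildren (sumAtDepth n g) x
sumAtDepth-sumOverChildren zero    g x = refl
sumAtDepth-sumOverChildren (suc n) g x = sumAtDepth-sumOverChildren n (sumOverChildren g) x

sumAtDepth-one : ∀ n x → sumAtDepth n (λ _ → 1) x ≡ descendants n x
sumAtDepth-one zero    x = refl
sumAtDepth-one (suc n) x =
  trans (sumAtDepth-sumOverChildren n (λ _ → 1) x) (sumBelow-cong (suc x) (λ k → sumAtDepth-one n (childLabel k x)))

Sortable-zero : Sortable 0 ↔ ⊤
Sortable-zero = mk↔ₛ′ (λ _ → tt) (λ _ → [] , tt) (λ _ → refl) unique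
  where
  empty : ∀ π → length π ≡ 0 → π ≡ []
  empty [] _ = refl
  unique : ∀ x → ([] , tt) ≡ x
  unique (π , p) = Sortable-≡ (sym (empty π (proj₁ (isPerm-sound 0 π (proj₁ (T-∧⁻ _ _ p))))))

Σ-Sortable-label : ∀ n (g : ℕ → ℕ) → Σ (Sortable n) (Fin ∘ g ∘ label ∘ proj₁) ↔ Fin (sumAtDepth n g 0)
Σ-Sortable-label zero g =
  ↔-trans (Σ-↔ Sortable-zero (λ {x} → Fin-cong (cong (g ∘ label ∘ proj₁) (sym (Inverse.strictlyInverseʳ Sortable-zero x))))) Σ-⊤
Σ-Sortable-label (suc n) g = begin
  Σ (Sortable (suc n)) (Fin ∘ g ∘ label ∘ proj₁)
    ↔⟨ Σ-↔ insertion (λ {x} → Fin-cong (cong g (relabel x))) ⟩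
  Σ (Σ (Sortable n) (Fin ∘ children)) (λ y → Fin (g (childLabel (toℕ (proj₂ y)) (label (proj₁ (proj₁ y))))))
    ↔⟨ Σ-assoc ⟩
  Σ (Sortable n) (λ s → Σ (Fin (children s)) (λ k → Fin (g (childLabel (toℕ k) (label (proj₁ s))))))
    ↔⟨ Σ-↔ ↔-refl (Σ-Fin-sumBelow _ _) ⟩
  Σ (Sortable n) (Fin ∘ sumOverChildren g ∘ label ∘ proj₁)
    ↔⟨ Σ-Sortable-label n (sumOverChildren g) ⟩
  Fin (sumAtDepth (suc n) g 0) ∎
  where
  open MaxInsertion n
  open EquationalReasoning
  relabel : ∀ x → label (proj₁ x) ≡ childLabel (toℕ (proj₂ (remove x))) (label (proj₁ (proj₁ (remove x))))
  relabel x = trans (cong (label ∘ proj₁) (sym (insert∘remove x))) (label-insert (remove x))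

mainTheorem4 : (n : ℕ) → 1 ≤ n →
    Fin (schroeder (n ∸ 1))
    ↔ Σ (List ℕ) (λ π → T (isPerm n π ∧ isSortable (p132 ∷ p231 ∷ []) π))
mainTheorem4 (suc m) _ = ↔-sym (begin
  Sortable (suc m)                              ↔⟨ Σ-Fin1 ⟨
  Σ (Sortable (suc m)) (λ _ → Fin 1)            ↔⟨ Σ-Sortable-label (suc m) (λ _ → 1) ⟩
  Fin (sumAtDepth (suc m) (λ _ → 1) 0)          ↔⟨ Fin-cong (trans (sumAtDepth-one (suc m) 0) (descendants-schroeder m)) ⟩
  Fin (schroeder m)                             ∎)
  where open EquationalReasoning
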